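{- Fix $\mathcal S$, $\mathcal A$, $\mathcal R$, and consider the PTS and the PTSC they determine. (1) If $\Gamma\vdash_{\mathsf{PTS}}t:T$ then $\mathcal A(\Gamma)\vdash\mathcal A(t):\mathcal A(T)$. (2) If, for each $i=1,\dots,n$, $\Gamma\vdash_{\mathsf{PTS}}t_i:T_i\{x_1:=t_1\}\cdots\{x_{i-1}:=t_{i-1}\}$, and $\mathcal A(\Gamma)\vdash\mathcal A(\Pi x_1^{T_1}.\cdots\Pi x_n^{T_n}.T):s$ for some sort $s$, then $\mathcal A(\Gamma);\mathcal A(\Pi x_1^{T_1}.\cdots\Pi x_n^{T_n}.T)\vdash\mathcal A(t_1)\cdot(\cdots(\mathcal A(t_n)\cdot[\,])\cdots):\mathcal A(T\{x_1:=t_1\}\cdots\{x_n:=t_n\})$. (3) If $\Gamma\ \mathsf{wf}$ in the PTS then $\mathcal A(\Gamma)\ \mathsf{wf}$ in the PTSC.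
   Context: Ground PTSC syntax: given sorts $\mathcal S$ and variables, terms $M ::= \Pi x^{A}.B \mid \lambda x^{A}.M \mid s \mid x\,l \mid M\,l \mid \langle N/x\rangle_A M$ and lists $l ::= [\,] \mid M\cdot l \mid l @ l' \mid \langle N/x\rangle_A l$ ($\langle N/x\rangle_A$ explicit substitution binding $x$; $\Pi,\lambda$ bind $x$). Reduction $\to$ is the contextual closure of: $(\lambda x^A.M)(N\cdot l)\to(\langle N/x\rangle_A M)\,l$; $M\,[\,]\to M$; $(x\,l)\,l'\to x\,(l@l')$; $(M\,l)\,l'\to M\,(l@l')$; $(M\cdot l')@l\to M\cdot(l'@l)$; $[\,]@l\to l$; $(l@l')@l''\to l@(l'@l'')$; $l@[\,]\to l$; $\langle P/y\rangle_G(\lambda x^A.M)\to\lambda x^{\langle P/y\rangle_G A}.\langle P/y\rangle_G M$; $\langle P/y\rangle_G(y\,l)\to P\,(\langle P/y\rangle_G l)$; $\langle P/y\rangle_G(x\,l)\to x\,(\langle P/y\rangle_G l)$ ($x\ne y$); $\langle P/y\rangle_G(M\,l)\to(\langle P/y\rangle_G M)(\langle P/y\rangle_G l)$; $\langle P/y\rangle_G(\Pi x^A.B)\to\Pi x^{\langle P/y\rangle_G A}.\langle P/y\rangle_G B$; $\langle P/y\rangle_G s\to s$; $\langle P/y\rangle_G[\,]\to[\,]$; $\langle P/y\rangle_G(M\cdot l)\to(\langle P/y\rangle_G M)\cdot(\langle P/y\rangle_G l)$; $\langle P/y\rangle_G(l@l')\to(\langle P/y\rangle_G l)@(\langle P/y\rangle_G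 l')$; $\leftrightarrow^*$ is the induced equivalence. PTSC typing (parameters $\mathcal A\subseteq\mathcal S^2$, $\mathcal R\subseteq\mathcal S^3$): environments are lists of $(x:A)$; $\langle P/x\rangle_A\Delta$ applies the substitution to every type of $\Delta$; $\Gamma\sqsubseteq\Delta$ means each $(x:A)\in\Gamma$ has some $(x:B)\in\Delta$ with $A\leftrightarrow^*B$. Rules: $\emptyset\ \mathsf{wf}$; $\Gamma\vdash A:s$, $x\notin\mathrm{dom}\,\Gamma\Rightarrow\Gamma,(x:A)\ \mathsf{wf}$; $\Gamma\ \mathsf{wf}$, $(s,s')\in\mathcal A\Rightarrow\Gamma\vdash s:s'$; $\Gamma\vdash A:s_1$, $\Gamma,(x:A)\vdash B:s_2$, $(s_1,s_2,s_3)\in\mathcal R\Rightarrow\Gamma\vdash\Pi x^A.B:s_3$; $\Gamma\vdash\Pi x^A.B:s$, $\Gamma,(x:A)\vdash M:B\Rightarrow\Gamma\vdash\lambda x^A.M:\Pi x^A.B$; $\Gamma;A\vdash l:B$, $(x:A)\in\Gamma\Rightarrow\Gamma\vdash x\,l:B$; $\Gamma\vdash A:s\Rightarrow\Gamma;A\vdash[\,]:A$; $\Gamma\vdash M:A$, $\Gamma\vdash B:s$, $A\leftrightarrow^*B\Rightarrow\Gamma\vdash M:B$; $\Gamma\vdash\Pi x^A.B:s$, $\Gamma\vdash M:A$, $\Gamma;\langle M/x\rangle_A B\vdash l:C\Rightarrow\Gamma;\Pi x^A.B\vdash M\cdot l:C$; $\Gamma;C\vdash l:A$, $\Gamma\vdash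 B:s$, $A\leftrightarrow^*B\Rightarrow\Gamma;C\vdash l:B$; $\Gamma;A\vdash l:C$, $\Gamma\vdash B:s$, $A\leftrightarrow^*B\Rightarrow\Gamma;B\vdash l:C$; $\Gamma;C\vdash l':A$, $\Gamma;A\vdash l:B\Rightarrow\Gamma;C\vdash l'@l:B$; $\Gamma\vdash P:A$, $\Gamma,(x:A),\Delta;B\vdash l:C$, $\Gamma,\langle P/x\rangle_A\Delta\sqsubseteq\Delta'$, $\Delta'\ \mathsf{wf}\Rightarrow\Delta';\langle P/x\rangle_A B\vdash\langle P/x\rangle_A l:\langle P/x\rangle_A C$; $\Gamma\vdash M:A$, $\Gamma;A\vdash l:B\Rightarrow\Gamma\vdash M\,l:B$; $\Gamma\vdash P:A$, $\Gamma,(x:A),\Delta\vdash M:C$, $\Gamma,\langle P/x\rangle_A\Delta\sqsubseteq\Delta'$, $\Delta'\ \mathsf{wf}\Rightarrow\Delta'\vdash\langle P/x\rangle_A M:C'$ with $C'=C$ if $C\in\mathcal S$, else $C'=\langle P/x\rangle_A C$. PTS: terms $t,u,T,U ::= x\mid s\mid\Pi x^T.t\mid\lambda x^T.t\mid t\,u$, $\beta$-reduction $(\lambda x^v.t)u\to t\{x:=u\}$, $\leftrightarrow_\beta^*$ its equivalence. PTS typing rules (same $\mathcal S,\mathcal A,\mathcal R$): $\emptyset\ \mathsf{wf}$; $\Gamma\vdash_{\mathsf{PTS}}T:s$, $x\notin\mathrm{dom}\,\Gamma\Rightarrow\Gamma,(x:T)\ \mathsf{wf}$; $\Gamma\ \mathsf{wf}$,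 $(x:T)\in\Gamma\Rightarrow\Gamma\vdash_{\mathsf{PTS}}x:T$; $\Gamma\ \mathsf{wf}$, $(s,s')\in\mathcal A\Rightarrow\Gamma\vdash_{\mathsf{PTS}}s:s'$; $\Gamma\vdash_{\mathsf{PTS}}U:s_1$, $\Gamma,(x:U)\vdash_{\mathsf{PTS}}T:s_2$, $(s_1,s_2,s_3)\in\mathcal R\Rightarrow\Gamma\vdash_{\mathsf{PTS}}\Pi x^U.T:s_3$; $\Gamma\vdash_{\mathsf{PTS}}\Pi x^U.T:s$, $\Gamma,(x:U)\vdash_{\mathsf{PTS}}t:T\Rightarrow\Gamma\vdash_{\mathsf{PTS}}\lambda x^U.t:\Pi x^U.T$; $\Gamma\vdash_{\mathsf{PTS}}t:\Pi x^U.T$, $\Gamma\vdash_{\mathsf{PTS}}u:U\Rightarrow\Gamma\vdash_{\mathsf{PTS}}t\,u:T\{x:=u\}$; $\Gamma\vdash_{\mathsf{PTS}}t:U$, $\Gamma\vdash_{\mathsf{PTS}}V:s$, $U\leftrightarrow_\beta^*V\Rightarrow\Gamma\vdash_{\mathsf{PTS}}t:V$. Translation $\mathcal A$ (PTS to PTSC): $\mathcal A(s)=s$, $\mathcal A(\Pi x^T.U)=\Pi x^{\mathcal A(T)}.\mathcal A(U)$, $\mathcal A(\lambda x^T.t)=\lambda x^{\mathcal A(T)}.\mathcal A(t)$, $\mathcal A(t)=\mathcal A_{[\,]}(t)$ if $t$ is a variable or application; $\mathcal A_l(t\,u)=\mathcal A_{\mathcal A(u)\cdot l}(t)$, $\mathcal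 A_l(x)=x\,l$, $\mathcal A_l(t)=\mathcal A(t)\,l$ otherwise. On environments: $\mathcal A(\emptyset)=\emptyset$, $\mathcal A(\Gamma,(x:T))=\mathcal A(\Gamma),(x:\mathcal A(T))$. -}

module Defs where

-- Conventions:
--  * Locally nameless, well-scoped syntax: `Tm n` / `PT n` / `PL n` are
--    (pre)terms with at most n dangling bound indices (de Bruijn indices,
--    0 = innermost binder); free variables are names in ℕ.  Closed-scope
--    terms (n = 0) are the terms of the paper, identified up to α.
--  * A named binder  B x^A. t  is written  B A (close x t).
--  * Environments are lists with the most recent declaration at the head:
--    Γ,(x:A) is (x , A) ∷ Γ, and Γ,(x:A),Δ is Δ ++ (x , A) ∷ Γ.

open import Data.Nat using (ℕ; zero; suc; _≟_)
open import Data.Fin using (Fin; zero; suc; fromℕ; inject₁)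
open import Data.Maybe using (Maybe; just; nothing; maybe′)
import Data.Maybe as Maybe
open import Data.List using (List; []; _∷_; _++_; map; foldr)
open import Data.Product using (_×_; _,_; proj₁; ∃)
open import Data.List.Membership.Propositional using (_∈_; _∉_)
open import Relation.Nullary using (yes; no)
open import Relation.Binary.PropositionalEquality using (_≢_)
open import Relation.Binary.Construct.Closure.Equivalence using (EqClosure)

-- removes the outermost bound index (the last element of Fin (suc m))
strip : ∀ {m} → Fin (suc m) → Maybe (Fin m)
strip {zero} zero = nothing
strip {zero} (suc ())
strip {suc m} zero = just zero
strip {suc m} (suc i) = Maybe.map suc (strip i)

liftF : ∀ {m n} → (Fin m → Fin n) → Fin (suc m) → Fin (suc n)
liftF f zero = zero
liftF f (suc i) = suc (f i)

module Theory (S : Set) (Ax : S → S → Set) (Rl : S → S → S → Set) where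

  data Tm (n : ℕ) : Set where
    bv  : Fin n → Tm n
    fv  : ℕ → Tm n
    srt : S → Tm n
    pi  : Tm n → Tm (suc n) → Tm n
    lam : Tm n → Tm (suc n) → Tm n
    app : Tm n → Tm n → Tm n

  ren : ∀ {m n} → (Fin m → Fin n) → Tm m → Tm n
  ren f (bv i) = bv (f i)
  ren f (fv x) = fv x
  ren f (srt s) = srt s
  ren f (pi A B) = pi (ren f A) (ren (liftF f) B)
  ren f (lam A t) = lam (ren f A) (ren (liftF f) t)
  ren f (app t u) = app (ren f t) (ren f u)

  emb : ∀ {m} → Tm 0 → Tm m
  emb = ren (λ ())

  -- abstraction of the free name x as a new outermost bound variable
  close : ∀ {m} → ℕ → Tm m → Tm (suc m)
  close x (bv i) = bv (inject₁ i)
  close {m} x (fv y) with x ≟ y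
  ... | yes _ = bv (fromℕ m)
  ... | no _ = fv y
  close x (srt s) = srt s
  close x (pi A B) = pi (close x A) (close x B)
  close x (lam A t) = lam (close x A) (close x t)
  close x (app t u) = app (close x t) (close x u)

  -- t {x := u}  (capture-free since u has no bound indices)
  substF : ∀ {m} → ℕ → Tm 0 → Tm m → Tm m
  substF x u (bv i) = bv i
  substF x u (fv y) with x ≟ y
  ... | yes _ = emb u
  ... | no _ = fv y
  substF x u (srt s) = srt s
  substF x u (pi A B) = pi (substF x u A) (substF x u B)
  substF x u (lam A t) = lam (substF x u A) (substF x u t)
  substF x u (app t v) = app (substF x u t) (substF x u v)

  infix 4 _→β_ _≡β_
  data _→β_ : Tm 0 → Tm 0 → Set where
    β     : ∀ x V t u → app (lam V (close x t)) u →β substF x u t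
    piL   : ∀ {A A' B} → A →β A' → pi A B →β pi A' B
    piR   : ∀ {A B B'} x → B →β B' → pi A (close x B) →β pi A (close x B')
    lamL  : ∀ {A A' t} → A →β A' → lam A t →β lam A' t
    lamR  : ∀ {A t t'} x → t →β t' → lam A (close x t) →β lam A (close x t')
    appL  : ∀ {t t' u} → t →β t' → app t u →β app t' u
    appR  : ∀ {t u u'} → u →β u' → app t u →β app t u'

  _≡β_ : Tm 0 → Tm 0 → Set
  _≡β_ = EqClosure _→β_

  Ctx : Set
  Ctx = List (ℕ × Tm 0)

  dom : ∀ {A : Set} → List (ℕ × A) → List ℕ
  dom = map proj₁

  infix 3 _⊢P_∶_
  data WfP : Ctx → Set
  data _⊢P_∶_ : Ctx → Tm 0 → Tm 0 → Set

  data WfP where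
    wf-nil  : WfP []
    wf-cons : ∀ {Γ T s x} → Γ ⊢P T ∶ srt s → x ∉ dom Γ → WfP ((x , T) ∷ Γ)

  data _⊢P_∶_ where
    tvar  : ∀ {Γ x T} → WfP Γ → (x , T) ∈ Γ → Γ ⊢P fv x ∶ T
    tsort : ∀ {Γ s s'} → WfP Γ → Ax s s' → Γ ⊢P srt s ∶ srt s'
    tpi   : ∀ {Γ U T x s₁ s₂ s₃} → Γ ⊢P U ∶ srt s₁ → (x , U) ∷ Γ ⊢P T ∶ srt s₂ →
            Rl s₁ s₂ s₃ → Γ ⊢P pi U (close x T) ∶ srt s₃
    tlam  : ∀ {Γ U T t x s} → Γ ⊢P pi U (close x T) ∶ srt s → (x , U) ∷ Γ ⊢P t ∶ T →
            Γ ⊢P lam U (close x t) ∶ pi U (close x T)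
    tapp  : ∀ {Γ t u U T x} → Γ ⊢P t ∶ pi U (close x T) → Γ ⊢P u ∶ U →
            Γ ⊢P app t u ∶ substF x u T
    tconv : ∀ {Γ t U V s} → Γ ⊢P t ∶ U → Γ ⊢P V ∶ srt s → U ≡β V → Γ ⊢P t ∶ V

  data PT (n : ℕ) : Set
  data PL (n : ℕ) : Set

  data PT n where
    Pi  : PT n → PT (suc n) → PT n
    Lam : PT n → PT (suc n) → PT n
    Srt : S → PT n
    BV  : Fin n → PL n → PT n
    FV  : ℕ → PL n → PT n
    App : PT n → PL n → PT n
    ES  : PT n → PT n → PT (suc n) → PT n   -- ES N A M = ⟨N/x⟩_A M

  data PL n where
    Nil  : PL n
    Cons : PT n → PL n → PL n
    Cat  : PL n → PL n → PL n
    ESL  : PT n → PT n → PL (suc n) → PL n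

  closeT : ∀ {m} → ℕ → PT m → PT (suc m)
  closeL : ∀ {m} → ℕ → PL m → PL (suc m)
  closeT x (Pi A B) = Pi (closeT x A) (closeT x B)
  closeT x (Lam A M) = Lam (closeT x A) (closeT x M)
  closeT x (Srt s) = Srt s
  closeT x (BV i l) = BV (inject₁ i) (closeL x l)
  closeT {m} x (FV y l) with x ≟ y
  ... | yes _ = BV (fromℕ m) (closeL x l)
  ... | no _ = FV y (closeL x l)
  closeT x (App M l) = App (closeT x M) (closeL x l)
  closeT x (ES N A M) = ES (closeT x N) (closeT x A) (closeT x M)
  closeL x Nil = Nil
  closeL x (Cons M l) = Cons (closeT x M) (closeL x l)
  closeL x (Cat l l') = Cat (closeL x l) (closeL x l')
  closeL x (ESL N A l) = ESL (closeT x N) (closeT x A) (closeL x l)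

  fvT : ∀ {m} → PT m → List ℕ
  fvL : ∀ {m} → PL m → List ℕ
  fvT (Pi A B) = fvT A ++ fvT B
  fvT (Lam A M) = fvT A ++ fvT M
  fvT (Srt s) = []
  fvT (BV i l) = fvL l
  fvT (FV x l) = x ∷ fvL l
  fvT (App M l) = fvT M ++ fvL l
  fvT (ES N A M) = fvT N ++ fvT A ++ fvT M
  fvL Nil = []
  fvL (Cons M l) = fvT M ++ fvL l
  fvL (Cat l l') = fvL l ++ fvL l'
  fvL (ESL N A l) = fvT N ++ fvT A ++ fvL l

  infix 4 _⟶_ _⟶L_ _↔*_
  data _⟶_ : PT 0 → PT 0 → Set
  data _⟶L_ : PL 0 → PL 0 → Set

  data _⟶_ where
    r-beta  : ∀ A M N l → App (Lam A M) (Cons N l) ⟶ App (ES N A M) l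
    r-nil   : ∀ M → App M Nil ⟶ M
    r-fvapp : ∀ x l l' → App (FV x l) l' ⟶ FV x (Cat l l')
    r-app   : ∀ M l l' → App (App M l) l' ⟶ App M (Cat l l')
    r-lam   : ∀ x y P G A M → x ≢ y → x ∉ fvT P → x ∉ fvT G →
              ES P G (closeT y (Lam A (closeT x M)))
                ⟶ Lam (ES P G (closeT y A)) (closeT x (ES P G (closeT y M)))
    r-var   : ∀ P G l → ES P G (BV zero l) ⟶ App P (ESL P G l)
    r-var'  : ∀ P G x l → ES P G (FV x l) ⟶ FV x (ESL P G l)
    r-esapp : ∀ P G M l → ES P G (App M l) ⟶ App (ES P G M) (ESL P G l)
    r-pi    : ∀ x y P G A B → x ≢ y → x ∉ fvT P → x ∉ fvT G →
              ES P G (closeT y (Pi A (closeT x B)))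
                ⟶ Pi (ES P G (closeT y A)) (closeT x (ES P G (closeT y B)))
    r-srt   : ∀ P G s → ES P G (Srt s) ⟶ Srt s
    c-piL   : ∀ {A A' B} → A ⟶ A' → Pi A B ⟶ Pi A' B
    c-piR   : ∀ {A B B'} x → B ⟶ B' → Pi A (closeT x B) ⟶ Pi A (closeT x B')
    c-lamL  : ∀ {A A' M} → A ⟶ A' → Lam A M ⟶ Lam A' M
    c-lamR  : ∀ {A M M'} x → M ⟶ M' → Lam A (closeT x M) ⟶ Lam A (closeT x M')
    c-fv    : ∀ {x l l'} → l ⟶L l' → FV x l ⟶ FV x l'
    c-appL  : ∀ {M M' l} → M ⟶ M' → App M l ⟶ App M' l
    c-appR  : ∀ {M l l'} → l ⟶L l' → App M l ⟶ App M l'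
    c-esN   : ∀ {N N' A M} → N ⟶ N' → ES N A M ⟶ ES N' A M
    c-esA   : ∀ {N A A' M} → A ⟶ A' → ES N A M ⟶ ES N A' M
    c-esM   : ∀ {N A M M'} x → M ⟶ M' → ES N A (closeT x M) ⟶ ES N A (closeT x M')

  data _⟶L_ where
    r-cons   : ∀ M l' l → Cat (Cons M l') l ⟶L Cons M (Cat l' l)
    r-catnil : ∀ l → Cat Nil l ⟶L l
    r-assoc  : ∀ l l' l'' → Cat (Cat l l') l'' ⟶L Cat l (Cat l' l'')
    r-nilcat : ∀ l → Cat l Nil ⟶L l
    r-esnil  : ∀ P G → ESL P G Nil ⟶L Nil
    r-escons : ∀ P G M l → ESL P G (Cons M l) ⟶L Cons (ES P G M) (ESL P G l)
    r-escat  : ∀ P G l l' → ESL P G (Cat l l') ⟶L Cat (ESL P G l) (ESL P G l')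
    c-consM  : ∀ {M M' l} → M ⟶ M' → Cons M l ⟶L Cons M' l
    c-consl  : ∀ {M l l'} → l ⟶L l' → Cons M l ⟶L Cons M l'
    c-catL   : ∀ {l₁ l₁' l₂} → l₁ ⟶L l₁' → Cat l₁ l₂ ⟶L Cat l₁' l₂
    c-catR   : ∀ {l₁ l₂ l₂'} → l₂ ⟶L l₂' → Cat l₁ l₂ ⟶L Cat l₁ l₂'
    c-esN    : ∀ {N N' A l} → N ⟶ N' → ESL N A l ⟶L ESL N' A l
    c-esA    : ∀ {N A A' l} → A ⟶ A' → ESL N A l ⟶L ESL N A' l
    c-esl    : ∀ {N A l l'} x → l ⟶L l' → ESL N A (closeL x l) ⟶L ESL N A (closeL x l')

  _↔*_ : PT 0 → PT 0 → Set
  _↔*_ = EqClosure _⟶_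

  CCtx : Set
  CCtx = List (ℕ × PT 0)

  substEnv : PT 0 → ℕ → PT 0 → CCtx → CCtx
  substEnv P x A = map (λ { (y , D) → y , ES P A (closeT x D) })

  infix 3 _⊑_
  _⊑_ : CCtx → CCtx → Set
  Γ ⊑ Δ = ∀ {y A} → (y , A) ∈ Γ → ∃ λ B → (y , B) ∈ Δ × A ↔* B

  -- C' in the typing rule of ⟨P/x⟩_A M
  substTy : PT 0 → ℕ → PT 0 → PT 0 → PT 0
  substTy P x A (Srt s) = Srt s
  substTy P x A C = ES P A (closeT x C)

  infix 3 _⊢_∶_ _⨾_⊢_∶_
  data Wf : CCtx → Set
  data _⊢_∶_ : CCtx → PT 0 → PT 0 → Set
  data _⨾_⊢_∶_ : CCtx → PT 0 → PL 0 → PT 0 → Set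

  data Wf where
    wf-nil  : Wf []
    wf-cons : ∀ {Γ A s x} → Γ ⊢ A ∶ Srt s → x ∉ dom Γ → Wf ((x , A) ∷ Γ)

  data _⊢_∶_ where
    sort  : ∀ {Γ s s'} → Wf Γ → Ax s s' → Γ ⊢ Srt s ∶ Srt s'
    pi    : ∀ {Γ A B x s₁ s₂ s₃} → Γ ⊢ A ∶ Srt s₁ → (x , A) ∷ Γ ⊢ B ∶ Srt s₂ →
            Rl s₁ s₂ s₃ → Γ ⊢ Pi A (closeT x B) ∶ Srt s₃
    lam   : ∀ {Γ A B M x s} → Γ ⊢ Pi A (closeT x B) ∶ Srt s → (x , A) ∷ Γ ⊢ M ∶ B →
            Γ ⊢ Lam A (closeT x M) ∶ Pi A (closeT x B)
    var   : ∀ {Γ A B l x} → Γ ⨾ A ⊢ l ∶ B → (x , A) ∈ Γ → Γ ⊢ FV x l ∶ B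
    convr : ∀ {Γ M A B s} → Γ ⊢ M ∶ A → Γ ⊢ B ∶ Srt s → A ↔* B → Γ ⊢ M ∶ B
    cut₃  : ∀ {Γ M A B l} → Γ ⊢ M ∶ A → Γ ⨾ A ⊢ l ∶ B → Γ ⊢ App M l ∶ B
    cut₄  : ∀ {Γ Δ Δ' P A M C x} → Γ ⊢ P ∶ A → Δ ++ (x , A) ∷ Γ ⊢ M ∶ C →
            substEnv P x A Δ ++ Γ ⊑ Δ' → Wf Δ' →
            Δ' ⊢ ES P A (closeT x M) ∶ substTy P x A C

  data _⨾_⊢_∶_ where
    ax    : ∀ {Γ A s} → Γ ⊢ A ∶ Srt s → Γ ⨾ A ⊢ Nil ∶ A
    Πl    : ∀ {Γ A B M l C s} → Γ ⊢ Pi A B ∶ Srt s → Γ ⊢ M ∶ A → Γ ⨾ ES M A B ⊢ l ∶ C →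
            Γ ⨾ Pi A B ⊢ Cons M l ∶ C
    convr : ∀ {Γ C l A B s} → Γ ⨾ C ⊢ l ∶ A → Γ ⊢ B ∶ Srt s → A ↔* B → Γ ⨾ C ⊢ l ∶ B
    convl : ∀ {Γ A l C B s} → Γ ⨾ A ⊢ l ∶ C → Γ ⊢ B ∶ Srt s → A ↔* B → Γ ⨾ B ⊢ l ∶ C
    cut₁  : ∀ {Γ C l' A l B} → Γ ⨾ C ⊢ l' ∶ A → Γ ⨾ A ⊢ l ∶ B → Γ ⨾ C ⊢ Cat l' l ∶ B
    cut₂  : ∀ {Γ Δ Δ' P A B l C x} → Γ ⊢ P ∶ A → Δ ++ (x , A) ∷ Γ ⨾ B ⊢ l ∶ C →
            substEnv P x A Δ ++ Γ ⊑ Δ' → Wf Δ' →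
            Δ' ⨾ ES P A (closeT x B) ⊢ ESL P A (closeL x l) ∶ ES P A (closeT x C)

  tr  : ∀ {m} → Tm m → PT m
  trl : ∀ {m} → PL m → Tm m → PT m
  tr (bv i) = BV i Nil
  tr (fv x) = FV x Nil
  tr (srt s) = Srt s
  tr (pi T U) = Pi (tr T) (tr U)
  tr (lam T t) = Lam (tr T) (tr t)
  tr (app t u) = trl (Cons (tr u) Nil) t
  trl l (app t u) = trl (Cons (tr u) l) t
  trl l (bv i) = BV i l
  trl l (fv x) = FV x l
  trl l (srt s) = App (Srt s) l
  trl l (pi T U) = App (Pi (tr T) (tr U)) l
  trl l (lam T t) = App (Lam (tr T) (tr t)) l

  trEnv : Ctx → CCtx
  trEnv = map (λ { (x , T) → x , tr T })

  seqSubst : List (ℕ × Tm 0) → Tm 0 → Tm 0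
  seqSubst [] T = T
  seqSubst ((x , t) ∷ ps) T = seqSubst ps (substF x t T)

  piChain : List (ℕ × Tm 0) → Tm 0 → Tm 0
  piChain [] T = T
  piChain ((x , U) ∷ ps) T = pi U (close x (piChain ps T))

  consList : List (PT 0) → PL 0
  consList = foldr Cons Nil

-- The named binders of the PTS (a body typed for ONE chosen name) do not
-- support the substitution lemma, so we first pass to an equivalent
-- cofinite presentation ⊢Q (a body typed for all but finitely many names)
-- and prove its metatheory: weakening, substitution, Π-generation, renaming.
-- Parts (1) and (3) then follow by induction on ⊢Q, using two facts about 𝒜:
-- 𝒜_l(t) ↔* 𝒜(t) l (spine-app) and ⟨𝒜(u)/x⟩ 𝒜(T) ↔* 𝒜(T{x:=u}) (es-elim),
-- so that 𝒜 maps β-conversion into ↔*.  Part (2) starts from a PTSC typing of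
-- the Π-chain and needs inversion; we get it from the back-translation
-- bk : PTSC → PTS, which preserves conversion and typing (soundness) and
-- satisfies bk ∘ 𝒜 = id, and then type the list one Π at a time.

module Submission where

open import Defs
open import Data.Nat using (ℕ; zero; suc; _≟_; _⊔_; _≤_; _<_; s≤s)
open import Data.Nat.Properties using (≤-refl; ≤-trans; m≤m⊔n; m≤n⊔m; <-irrefl; m⊔n<o⇒m<o; m⊔n<o⇒n<o)
open import Data.Fin using (Fin; zero; suc; fromℕ; inject₁; toℕ)
open import Data.Maybe using (just; nothing; maybe′)
open import Data.Vec using (Vec; lookup; toList; zip) renaming ([] to []ᵥ; _∷_ to _∷ᵥ_)
import Data.Vec as Vec
open import Data.Vec.Properties using (lookup-map)
open import Data.List using (List; []; _∷_; _++_; map; foldr; take)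
open import Data.List.Properties using (map-++; ++-assoc; ++-identityʳ; map-∘; map-cong)
open import Data.List.Membership.Propositional using (_∈_; _∉_)
open import Data.List.Membership.Propositional.Properties using (∈-++⁺ˡ; ∈-++⁺ʳ; ∈-++⁻; ∈-map⁺; ∈-map⁻)
open import Data.List.Relation.Unary.Any using (here; there)
open import Data.List.Relation.Unary.All using (All) renaming ([] to []ₐ; _∷_ to _∷ₐ_)
import Data.List.Relation.Unary.All as All
open import Data.List.Relation.Unary.AllPairs using () renaming (_∷_ to _∷ₚ_)
open import Data.List.Relation.Unary.Unique.Propositional using (Unique)
open import Data.Product using (_×_; _,_; proj₁; proj₂; ∃; Σ)
open import Data.Sum using (_⊎_; inj₁; inj₂)
import Data.Sum as Sum
open import Data.Empty using (⊥-elim)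
open import Relation.Nullary using (yes; no)
open import Relation.Binary.PropositionalEquality
open import Relation.Binary.Construct.Closure.Equivalence using (EqClosure; gmap; gfold; symmetric; transitive; return) renaming (isEquivalence to eqc-isEquivalence)
open import Relation.Binary.Construct.Closure.ReflexiveTransitive using (ε)

∉-++ˡ : ∀ {A : Set} {x : A} xs {ys} → x ∉ xs ++ ys → x ∉ xs
∉-++ˡ xs p q = p (∈-++⁺ˡ q)

∉-++ʳ : ∀ {A : Set} {x : A} xs {ys} → x ∉ xs ++ ys → x ∉ ys
∉-++ʳ xs p q = p (∈-++⁺ʳ xs q)

∉-++ : ∀ {A : Set} {x : A} xs {ys} → x ∉ xs → x ∉ ys → x ∉ xs ++ ys
∉-++ xs p q r with ∈-++⁻ xs r
... | inj₁ a = p a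
... | inj₂ b = q b

maxL : List ℕ → ℕ
maxL = foldr _⊔_ 0

∈⇒≤maxL : ∀ {x} xs → x ∈ xs → x ≤ maxL xs
∈⇒≤maxL (y ∷ ys) (here refl) = m≤m⊔n y (maxL ys)
∈⇒≤maxL (y ∷ ys) (there p) = ≤-trans (∈⇒≤maxL ys p) (m≤n⊔m y (maxL ys))

fresh : List ℕ → ℕ
fresh xs = suc (maxL xs)

fresh-∉ : ∀ xs → fresh xs ∉ xs
fresh-∉ xs p = <-irrefl refl (∈⇒≤maxL xs p)

strip-inject : ∀ {m} (i : Fin m) → strip (inject₁ i) ≡ just i
strip-inject {suc zero} zero = refl
strip-inject {suc (suc m)} zero = refl
strip-inject {suc m} (suc i) rewrite strip-inject i = refl

strip-fromℕ : ∀ m → strip (fromℕ m) ≡ nothing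
strip-fromℕ zero = refl
strip-fromℕ (suc m) rewrite strip-fromℕ m = refl

strip-just : ∀ {m} (i : Fin (suc m)) {j} → strip i ≡ just j → i ≡ inject₁ j
strip-just {zero} zero ()
strip-just {suc m} zero refl = refl
strip-just {suc m} (suc i) e with strip i in eq
strip-just {suc m} (suc i) refl | just k = cong suc (strip-just i eq)
strip-just {suc m} (suc i) () | nothing

strip-nothing : ∀ {m} (i : Fin (suc m)) → strip i ≡ nothing → i ≡ fromℕ m
strip-nothing {zero} zero e = refl
strip-nothing {suc m} zero ()
strip-nothing {suc m} (suc i) e with strip i in eq
strip-nothing {suc m} (suc i) () | just k
strip-nothing {suc m} (suc i) refl | nothing = cong suc (strip-nothing i eq)

module Correctness (S : Set) (Ax : S → S → Set) (Rl : S → S → S → Set) where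
  open Theory S Ax Rl

  -- A binder body is a
  -- Tm (suc m); `close x` abstracts the name x as its outermost bound index
  -- and `inst u` (below) instantiates that index by a closed term u.

  fvs : ∀ {m} → Tm m → List ℕ
  fvs (bv i) = []
  fvs (fv x) = x ∷ []
  fvs (srt s) = []
  fvs (pi A B) = fvs A ++ fvs B
  fvs (lam A t) = fvs A ++ fvs t
  fvs (app t u) = fvs t ++ fvs u

  record FreshFor (L : List ℕ) (B : Tm 1) : Set where
    field
      y : ℕ
      y∉L : y ∉ L
      y∉B : y ∉ fvs B

  fresh-for : ∀ L B → FreshFor L B
  fresh-for L B = record
    { y = fresh (L ++ fvs B)
    ; y∉L = ∉-++ˡ L (fresh-∉ (L ++ fvs B))
    ; y∉B = ∉-++ʳ L (fresh-∉ (L ++ fvs B)) }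

  -- Height of a term; it is invariant under opening with a name and serves as
  -- the measure for es-elim, which recurses into opened binder bodies.
  size : ∀ {m} → Tm m → ℕ
  size (bv i) = 0
  size (fv x) = 0
  size (srt s) = 0
  size (pi A B) = suc (size A ⊔ size B)
  size (lam A t) = suc (size A ⊔ size t)
  size (app t u) = suc (size t ⊔ size u)

  liftF-ext : ∀ {m n} {f g : Fin m → Fin n} → (∀ i → f i ≡ g i) → ∀ i → liftF f i ≡ liftF g i
  liftF-ext e zero = refl
  liftF-ext e (suc i) = cong suc (e i)

  ren-ext : ∀ {m n} {f g : Fin m → Fin n} → (∀ i → f i ≡ g i) → (t : Tm m) → ren f t ≡ ren g t
  ren-ext e (bv i) = cong bv (e i)
  ren-ext e (fv x) = refl
  ren-ext e (srt s) = refl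
  ren-ext e (pi A B) = cong₂ pi (ren-ext e A) (ren-ext (liftF-ext e) B)
  ren-ext e (lam A B) = cong₂ lam (ren-ext e A) (ren-ext (liftF-ext e) B)
  ren-ext e (app t u) = cong₂ app (ren-ext e t) (ren-ext e u)

  liftF-fuse : ∀ {k m n} {f : Fin m → Fin n} {g : Fin k → Fin m} {h : Fin k → Fin n} →
               (∀ i → f (g i) ≡ h i) → ∀ i → liftF f (liftF g i) ≡ liftF h i
  liftF-fuse e zero = refl
  liftF-fuse e (suc i) = cong suc (e i)

  ren-fuse : ∀ {k m n} {f : Fin m → Fin n} {g : Fin k → Fin m} {h : Fin k → Fin n} →
             (∀ i → f (g i) ≡ h i) → (t : Tm k) → ren f (ren g t) ≡ ren h t
  ren-fuse e (bv i) = cong bv (e i)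
  ren-fuse e (fv x) = refl
  ren-fuse e (srt s) = refl
  ren-fuse e (pi A B) = cong₂ pi (ren-fuse e A) (ren-fuse (liftF-fuse e) B)
  ren-fuse e (lam A B) = cong₂ lam (ren-fuse e A) (ren-fuse (liftF-fuse e) B)
  ren-fuse e (app t u) = cong₂ app (ren-fuse e t) (ren-fuse e u)

  liftF-id : ∀ {m} {f : Fin m → Fin m} → (∀ i → f i ≡ i) → ∀ i → liftF f i ≡ i
  liftF-id e zero = refl
  liftF-id e (suc i) = cong suc (e i)

  ren-id : ∀ {m} {f : Fin m → Fin m} → (∀ i → f i ≡ i) → (t : Tm m) → ren f t ≡ t
  ren-id e (bv i) = cong bv (e i)
  ren-id e (fv x) = refl
  ren-id e (srt s) = refl
  ren-id e (pi A B) = cong₂ pi (ren-id e A) (ren-id (liftF-id e) B)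
  ren-id e (lam A B) = cong₂ lam (ren-id e A) (ren-id (liftF-id e) B)
  ren-id e (app t u) = cong₂ app (ren-id e t) (ren-id e u)

  -- A closed term has no bound indices, so embedding it is inert.
  emb-id : (u : Tm 0) → emb u ≡ u
  emb-id u = ren-id (λ ()) u

  ren-emb : ∀ {m n} (f : Fin m → Fin n) (u : Tm 0) → ren f (emb u) ≡ emb u
  ren-emb f u = ren-fuse (λ ()) u

  fvs-ren : ∀ {m n} (f : Fin m → Fin n) (t : Tm m) → fvs (ren f t) ≡ fvs t
  fvs-ren f (bv i) = refl
  fvs-ren f (fv x) = refl
  fvs-ren f (srt s) = refl
  fvs-ren f (pi A B) = cong₂ _++_ (fvs-ren f A) (fvs-ren (liftF f) B)
  fvs-ren f (lam A B) = cong₂ _++_ (fvs-ren f A) (fvs-ren (liftF f) B)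
  fvs-ren f (app t u) = cong₂ _++_ (fvs-ren f t) (fvs-ren f u)

  fvs-emb : ∀ {m} (u : Tm 0) → fvs (emb {m} u) ≡ fvs u
  fvs-emb u = fvs-ren (λ ()) u

  close-fv-yes : ∀ {m} x → close {m} x (fv x) ≡ bv (fromℕ m)
  close-fv-yes x with x ≟ x
  ... | yes _ = refl
  ... | no x≢x = ⊥-elim (x≢x refl)

  close-fv-no : ∀ {m} {x y} → x ≢ y → close {m} x (fv y) ≡ fv y
  close-fv-no {x = x} {y} x≢y with x ≟ y
  ... | yes x≡y = ⊥-elim (x≢y x≡y)
  ... | no _ = refl

  substF-fv-yes : ∀ {m} x u → substF {m} x u (fv x) ≡ emb u
  substF-fv-yes x u with x ≟ x
  ... | yes _ = refl
  ... | no x≢x = ⊥-elim (x≢x refl)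

  substF-fv-no : ∀ {m} {x y} u → x ≢ y → substF {m} x u (fv y) ≡ fv y
  substF-fv-no {x = x} {y} u x≢y with x ≟ y
  ... | yes x≡y = ⊥-elim (x≢y x≡y)
  ... | no _ = refl

  inst : ∀ {m} → Tm 0 → Tm (suc m) → Tm m
  inst u (bv i) = maybe′ bv (emb u) (strip i)
  inst u (fv y) = fv y
  inst u (srt s) = srt s
  inst u (pi A B) = pi (inst u A) (inst u B)
  inst u (lam A t) = lam (inst u A) (inst u t)
  inst u (app t v) = app (inst u t) (inst u v)

  inst-close : ∀ {m} x u (t : Tm m) → inst u (close x t) ≡ substF x u t
  inst-close x u (bv i) rewrite strip-inject i = refl
  inst-close {m} x u (fv y) with x ≟ y
  ... | yes _ rewrite strip-fromℕ m = refl
  ... | no _ = refl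
  inst-close x u (srt s) = refl
  inst-close x u (pi A B) = cong₂ pi (inst-close x u A) (inst-close x u B)
  inst-close x u (lam A B) = cong₂ lam (inst-close x u A) (inst-close x u B)
  inst-close x u (app t v) = cong₂ app (inst-close x u t) (inst-close x u v)

  close-inst : ∀ {m} x (b : Tm (suc m)) → x ∉ fvs b → close x (inst (fv x) b) ≡ b
  close-inst x (bv i) x∉ with strip i in eq
  ... | just j rewrite strip-just i eq = refl
  ... | nothing rewrite strip-nothing i eq = close-fv-yes x
  close-inst x (fv y) x∉ = close-fv-no (λ e → x∉ (here e))
  close-inst x (srt s) x∉ = refl
  close-inst x (pi A B) x∉ = cong₂ pi (close-inst x A (∉-++ˡ (fvs A) x∉)) (close-inst x B (∉-++ʳ (fvs A) x∉))
  close-inst x (lam A B) x∉ = cong₂ lam (close-inst x A (∉-++ˡ (fvs A) x∉)) (close-inst x B (∉-++ʳ (fvs A) x∉))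
  close-inst x (app A B) x∉ = cong₂ app (close-inst x A (∉-++ˡ (fvs A) x∉)) (close-inst x B (∉-++ʳ (fvs A) x∉))

  substF-ren : ∀ {m n} x u (f : Fin m → Fin n) (t : Tm m) → substF x u (ren f t) ≡ ren f (substF x u t)
  substF-ren x u f (bv i) = refl
  substF-ren x u f (fv y) with x ≟ y
  ... | yes _ = sym (ren-emb f u)
  ... | no _ = refl
  substF-ren x u f (srt s) = refl
  substF-ren x u f (pi A B) = cong₂ pi (substF-ren x u f A) (substF-ren x u (liftF f) B)
  substF-ren x u f (lam A B) = cong₂ lam (substF-ren x u f A) (substF-ren x u (liftF f) B)
  substF-ren x u f (app t v) = cong₂ app (substF-ren x u f t) (substF-ren x u f v)

  substF-emb : ∀ {m} x u (v : Tm 0) → substF {m} x u (emb v) ≡ emb (substF x u v)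
  substF-emb x u v = substF-ren x u (λ ()) v

  substF-fresh : ∀ {m} x u (t : Tm m) → x ∉ fvs t → substF x u t ≡ t
  substF-fresh x u (bv i) x∉ = refl
  substF-fresh x u (fv y) x∉ = substF-fv-no u (λ e → x∉ (here e))
  substF-fresh x u (srt s) x∉ = refl
  substF-fresh x u (pi A B) x∉ = cong₂ pi (substF-fresh x u A (∉-++ˡ (fvs A) x∉)) (substF-fresh x u B (∉-++ʳ (fvs A) x∉))
  substF-fresh x u (lam A B) x∉ = cong₂ lam (substF-fresh x u A (∉-++ˡ (fvs A) x∉)) (substF-fresh x u B (∉-++ʳ (fvs A) x∉))
  substF-fresh x u (app A B) x∉ = cong₂ app (substF-fresh x u A (∉-++ˡ (fvs A) x∉)) (substF-fresh x u B (∉-++ʳ (fvs A) x∉))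

  liftF-inject₁ : ∀ {m} (i : Fin (suc m)) → inject₁ i ≡ liftF inject₁ i
  liftF-inject₁ zero = refl
  liftF-inject₁ (suc i) = refl

  close-fresh : ∀ {m} x (t : Tm m) → x ∉ fvs t → close x t ≡ ren inject₁ t
  close-fresh x (bv i) x∉ = refl
  close-fresh x (fv y) x∉ = close-fv-no (λ e → x∉ (here e))
  close-fresh x (srt s) x∉ = refl
  close-fresh x (pi A B) x∉ = cong₂ pi (close-fresh x A (∉-++ˡ (fvs A) x∉))
    (trans (close-fresh x B (∉-++ʳ (fvs A) x∉)) (ren-ext liftF-inject₁ B))
  close-fresh x (lam A B) x∉ = cong₂ lam (close-fresh x A (∉-++ˡ (fvs A) x∉))
    (trans (close-fresh x B (∉-++ʳ (fvs A) x∉)) (ren-ext liftF-inject₁ B))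
  close-fresh x (app A B) x∉ = cong₂ app (close-fresh x A (∉-++ˡ (fvs A) x∉)) (close-fresh x B (∉-++ʳ (fvs A) x∉))

  close-emb : ∀ {m} x (u : Tm 0) → x ∉ fvs u → close {m} x (emb u) ≡ emb u
  close-emb x u x∉ = trans (close-fresh x (emb u) (subst (x ∉_) (sym (fvs-emb u)) x∉)) (ren-emb inject₁ u)

  strip-liftF : ∀ {k m} {f : Fin k → Fin (suc m)} {g : Fin k → Fin m} → (∀ i → strip (f i) ≡ just (g i)) →
                ∀ i → strip (liftF f i) ≡ just (liftF g i)
  strip-liftF e zero = refl
  strip-liftF e (suc i) rewrite e i = refl

  inst-ren : ∀ {k m} w (f : Fin k → Fin (suc m)) (g : Fin k → Fin m) → (∀ i → strip (f i) ≡ just (g i)) →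
             (t : Tm k) → inst w (ren f t) ≡ ren g t
  inst-ren w f g e (bv i) rewrite e i = refl
  inst-ren w f g e (fv x) = refl
  inst-ren w f g e (srt s) = refl
  inst-ren w f g e (pi A B) = cong₂ pi (inst-ren w f g e A) (inst-ren w (liftF f) (liftF g) (strip-liftF e) B)
  inst-ren w f g e (lam A B) = cong₂ lam (inst-ren w f g e A) (inst-ren w (liftF f) (liftF g) (strip-liftF e) B)
  inst-ren w f g e (app t u) = cong₂ app (inst-ren w f g e t) (inst-ren w f g e u)

  inst-emb : ∀ {m} w (u : Tm 0) → inst {m} w (emb u) ≡ emb u
  inst-emb w u = inst-ren w (λ ()) (λ ()) (λ ()) u

  substF-inst : ∀ {m} x u v (b : Tm (suc m)) → substF x u (inst v b) ≡ inst (substF x u v) (substF x u b)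
  substF-inst x u v (bv i) with strip i
  ... | just j = refl
  ... | nothing = substF-emb x u v
  substF-inst x u v (fv y) with x ≟ y
  ... | yes _ = sym (inst-emb (substF x u v) u)
  ... | no _ = refl
  substF-inst x u v (srt s) = refl
  substF-inst x u v (pi A B) = cong₂ pi (substF-inst x u v A) (substF-inst x u v B)
  substF-inst x u v (lam A B) = cong₂ lam (substF-inst x u v A) (substF-inst x u v B)
  substF-inst x u v (app A B) = cong₂ app (substF-inst x u v A) (substF-inst x u v B)

  substF-inst-fv : ∀ {m} x u {y} (b : Tm (suc m)) → x ≢ y → substF x u (inst (fv y) b) ≡ inst (fv y) (substF x u b)
  substF-inst-fv x u b x≢y = trans (substF-inst x u _ b) (cong (λ z → inst z (substF x u b)) (substF-fv-no u x≢y))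

  substF-inst-fresh : ∀ {m} y u (b : Tm (suc m)) → y ∉ fvs b → substF y u (inst (fv y) b) ≡ inst u b
  substF-inst-fresh y u b y∉ = trans (substF-inst y u (fv y) b)
    (cong₂ inst (trans (substF-fv-yes y u) (emb-id u)) (substF-fresh y u b y∉))

  substF-close : ∀ {m} x u y (t : Tm m) → x ≢ y → y ∉ fvs u → substF x u (close y t) ≡ close y (substF x u t)
  substF-close x u y (bv i) x≢y y∉ = refl
  substF-close {m} x u y (fv z) x≢y y∉ with y ≟ z
  ... | yes refl rewrite substF-fv-no {m} u x≢y | close-fv-yes {m} y = refl
  ... | no y≢z with x ≟ z
  ...   | yes refl = sym (close-emb y u y∉)
  ...   | no _ = sym (close-fv-no y≢z)
  substF-close x u y (srt s) x≢y y∉ = refl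
  substF-close x u y (pi A B) x≢y y∉ = cong₂ pi (substF-close x u y A x≢y y∉) (substF-close x u y B x≢y y∉)
  substF-close x u y (lam A B) x≢y y∉ = cong₂ lam (substF-close x u y A x≢y y∉) (substF-close x u y B x≢y y∉)
  substF-close x u y (app A B) x≢y y∉ = cong₂ app (substF-close x u y A x≢y y∉) (substF-close x u y B x≢y y∉)

  fvs-inst⁺ : ∀ {m} {z} v (b : Tm (suc m)) → z ∈ fvs b → z ∈ fvs (inst v b)
  fvs-inst⁺ v (fv y) p = p
  fvs-inst⁺ v (pi A B) p with ∈-++⁻ (fvs A) p
  ... | inj₁ q = ∈-++⁺ˡ (fvs-inst⁺ v A q)
  ... | inj₂ q = ∈-++⁺ʳ (fvs (inst v A)) (fvs-inst⁺ v B q)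
  fvs-inst⁺ v (lam A B) p with ∈-++⁻ (fvs A) p
  ... | inj₁ q = ∈-++⁺ˡ (fvs-inst⁺ v A q)
  ... | inj₂ q = ∈-++⁺ʳ (fvs (inst v A)) (fvs-inst⁺ v B q)
  fvs-inst⁺ v (app A B) p with ∈-++⁻ (fvs A) p
  ... | inj₁ q = ∈-++⁺ˡ (fvs-inst⁺ v A q)
  ... | inj₂ q = ∈-++⁺ʳ (fvs (inst v A)) (fvs-inst⁺ v B q)

  fvs-substF : ∀ {m} {z} x u (t : Tm m) → z ∈ fvs (substF x u t) → z ∈ fvs u ⊎ z ∈ fvs t
  fvs-substF {z = z} x u (fv y) p with x ≟ y
  ... | yes _ = inj₁ (subst (z ∈_) (fvs-emb u) p)
  ... | no _ = inj₂ p
  fvs-substF x u (pi A B) p with ∈-++⁻ (fvs (substF x u A)) p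
  ... | inj₁ q = Sum.map₂ ∈-++⁺ˡ (fvs-substF x u A q)
  ... | inj₂ q = Sum.map₂ (∈-++⁺ʳ (fvs A)) (fvs-substF x u B q)
  fvs-substF x u (lam A B) p with ∈-++⁻ (fvs (substF x u A)) p
  ... | inj₁ q = Sum.map₂ ∈-++⁺ˡ (fvs-substF x u A q)
  ... | inj₂ q = Sum.map₂ (∈-++⁺ʳ (fvs A)) (fvs-substF x u B q)
  fvs-substF x u (app A B) p with ∈-++⁻ (fvs (substF x u A)) p
  ... | inj₁ q = Sum.map₂ ∈-++⁺ˡ (fvs-substF x u A q)
  ... | inj₂ q = Sum.map₂ (∈-++⁺ʳ (fvs A)) (fvs-substF x u B q)

  ∉-substF : ∀ {m} {z} x u (t : Tm m) → z ∉ fvs u → z ∉ fvs t → z ∉ fvs (substF x u t)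
  ∉-substF x u t z∉u z∉t p = Sum.[ z∉u , z∉t ] (fvs-substF x u t p)

  size-inst : ∀ {m} x (b : Tm (suc m)) → size (inst (fv x) b) ≡ size b
  size-inst x (bv i) with strip i
  ... | just _ = refl
  ... | nothing = refl
  size-inst x (fv y) = refl
  size-inst x (srt s) = refl
  size-inst x (pi A B) = cong₂ (λ a b → suc (a ⊔ b)) (size-inst x A) (size-inst x B)
  size-inst x (lam A B) = cong₂ (λ a b → suc (a ⊔ b)) (size-inst x A) (size-inst x B)
  size-inst x (app A B) = cong₂ (λ a b → suc (a ⊔ b)) (size-inst x A) (size-inst x B)

  -- Unlike →β it is closed under substitution (⇒β-substF),
  -- and →β-conversion implies ⇒β-conversion (≡β⇒≡β').
  infix 4 _⇒β_ _≡β'_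
  data _⇒β_ : Tm 0 → Tm 0 → Set where
    bβ    : ∀ V b u → app (lam V b) u ⇒β inst u b
    bpiL  : ∀ {A A' B} → A ⇒β A' → pi A B ⇒β pi A' B
    bpiR  : ∀ {A B B'} (L : List ℕ) → (∀ y → y ∉ L → inst (fv y) B ⇒β inst (fv y) B') → pi A B ⇒β pi A B'
    blamL : ∀ {A A' B} → A ⇒β A' → lam A B ⇒β lam A' B
    blamR : ∀ {A B B'} (L : List ℕ) → (∀ y → y ∉ L → inst (fv y) B ⇒β inst (fv y) B') → lam A B ⇒β lam A B'
    bappL : ∀ {t t' u} → t ⇒β t' → app t u ⇒β app t' u
    bappR : ∀ {t u u'} → u ⇒β u' → app t u ⇒β app t u'

  _≡β'_ : Tm 0 → Tm 0 → Set
  _≡β'_ = EqClosure _⇒β_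

  ≡sym : ∀ {a b} → a ≡β' b → b ≡β' a
  ≡sym = symmetric _⇒β_

  infixr 5 _≡∘_
  _≡∘_ : ∀ {a b c} → a ≡β' b → b ≡β' c → a ≡β' c
  _≡∘_ = transitive _⇒β_

  ≡one : ∀ {a b} → a ⇒β b → a ≡β' b
  ≡one = return

  ≡≡ : ∀ {a b} → a ≡ b → a ≡β' b
  ≡≡ refl = ε

  ⇒β-substF : ∀ x u {t t'} → t ⇒β t' → substF x u t ⇒β substF x u t'
  ⇒β-substF-body : ∀ x u B B' (L : List ℕ) → (∀ y → y ∉ L → inst (fv y) B ⇒β inst (fv y) B') →
                   ∀ y → y ∉ x ∷ L → inst (fv y) (substF x u B) ⇒β inst (fv y) (substF x u B')

  ⇒β-substF x u (bβ V b v) = subst (app (lam (substF x u V) (substF x u b)) (substF x u v) ⇒β_)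
                                (sym (substF-inst x u v b)) (bβ _ _ _)
  ⇒β-substF x u (bpiL r) = bpiL (⇒β-substF x u r)
  ⇒β-substF x u (bpiR {B = B} {B'} L body) = bpiR (x ∷ L) (⇒β-substF-body x u B B' L body)
  ⇒β-substF x u (blamL r) = blamL (⇒β-substF x u r)
  ⇒β-substF x u (blamR {B = B} {B'} L body) = blamR (x ∷ L) (⇒β-substF-body x u B B' L body)
  ⇒β-substF x u (bappL r) = bappL (⇒β-substF x u r)
  ⇒β-substF x u (bappR r) = bappR (⇒β-substF x u r)

  ⇒β-substF-body x u B B' L body y y∉ =
    subst₂ _⇒β_ (substF-inst-fv x u B x≢y) (substF-inst-fv x u B' x≢y) (⇒β-substF x u (body y (λ q → y∉ (there q))))
    where x≢y = λ e → y∉ (here (sym e))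

  ≡β-substF : ∀ x u {t t'} → t ≡β' t' → substF x u t ≡β' substF x u t'
  ≡β-substF x u = gmap (substF x u) (⇒β-substF x u)

  ⇒β-open-close : ∀ x {t t'} → t ⇒β t' → ∀ y → y ∉ [] → inst (fv y) (close x t) ⇒β inst (fv y) (close x t')
  ⇒β-open-close x {t} {t'} r y _ =
    subst₂ _⇒β_ (sym (inst-close x (fv y) t)) (sym (inst-close x (fv y) t')) (⇒β-substF x (fv y) r)

  ≡-pi-close : ∀ A x {t t'} → t ≡β' t' → pi A (close x t) ≡β' pi A (close x t')
  ≡-pi-close A x = gmap (λ t → pi A (close x t)) (λ r → bpiR [] (⇒β-open-close x r))

  ≡-lam-close : ∀ A x {t t'} → t ≡β' t' → lam A (close x t) ≡β' lam A (close x t')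
  ≡-lam-close A x = gmap (λ t → lam A (close x t)) (λ r → blamR [] (⇒β-open-close x r))

  ≡-piL : ∀ {A A'} B → A ≡β' A' → pi A B ≡β' pi A' B
  ≡-piL B = gmap (λ A → pi A B) bpiL

  ≡-lamL : ∀ {A A'} B → A ≡β' A' → lam A B ≡β' lam A' B
  ≡-lamL B = gmap (λ A → lam A B) blamL

  ≡-appL : ∀ {t t'} u → t ≡β' t' → app t u ≡β' app t' u
  ≡-appL u = gmap (λ t → app t u) bappL

  ≡-appR : ∀ t {u u'} → u ≡β' u' → app t u ≡β' app t u'
  ≡-appR t = gmap (λ u → app t u) bappR

  →β⇒≡β' : ∀ {t t'} → t →β t' → t ≡β' t'
  →β⇒≡β' (β x V t u) = ≡one (subst (app (lam V (close x t)) u ⇒β_) (inst-close x u t) (bβ V (close x t) u))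
  →β⇒≡β' (piL r) = ≡-piL _ (→β⇒≡β' r)
  →β⇒≡β' (piR x r) = ≡-pi-close _ x (→β⇒≡β' r)
  →β⇒≡β' (lamL r) = ≡-lamL _ (→β⇒≡β' r)
  →β⇒≡β' (lamR x r) = ≡-lam-close _ x (→β⇒≡β' r)
  →β⇒≡β' (appL r) = ≡-appL _ (→β⇒≡β' r)
  →β⇒≡β' (appR r) = ≡-appR _ (→β⇒≡β' r)

  ≡β⇒≡β' : ∀ {t t'} → t ≡β t' → t ≡β' t'
  ≡β⇒≡β' = gfold (eqc-isEquivalence _⇒β_) (λ t → t) →β⇒≡β'

  -- A binder body is typed for every
  -- name outside a finite list L, and each rule carries the extra typing
  -- premisses that make weakening, substitution and generation provable by
  -- plain induction.
  infix 3 _⊢Q_∶_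
  data WfQ : Ctx → Set
  data _⊢Q_∶_ : Ctx → Tm 0 → Tm 0 → Set

  data WfQ where
    qnil  : WfQ []
    qcons : ∀ {Γ T s x} → Γ ⊢Q T ∶ srt s → x ∉ dom Γ → WfQ ((x , T) ∷ Γ)

  data _⊢Q_∶_ where
    qvar  : ∀ {Γ x T s} → WfQ Γ → (x , T) ∈ Γ → Γ ⊢Q T ∶ srt s → Γ ⊢Q fv x ∶ T
    qsort : ∀ {Γ s s'} → WfQ Γ → Ax s s' → Γ ⊢Q srt s ∶ srt s'
    qpi   : ∀ {Γ U B s₁ s₂ s₃} → Γ ⊢Q U ∶ srt s₁ → (L : List ℕ) →
            (∀ y → y ∉ L → (y , U) ∷ Γ ⊢Q inst (fv y) B ∶ srt s₂) → Rl s₁ s₂ s₃ →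
            Γ ⊢Q pi U B ∶ srt s₃
    qlam  : ∀ {Γ U B b s} → Γ ⊢Q pi U B ∶ srt s → (L : List ℕ) →
            (∀ y → y ∉ L → (y , U) ∷ Γ ⊢Q inst (fv y) b ∶ inst (fv y) B) →
            Γ ⊢Q lam U b ∶ pi U B
    qapp  : ∀ {Γ t u U B s s₂ s'} → Γ ⊢Q t ∶ pi U B → Γ ⊢Q u ∶ U → Γ ⊢Q pi U B ∶ srt s → (L : List ℕ) →
            (∀ y → y ∉ L → (y , U) ∷ Γ ⊢Q inst (fv y) B ∶ srt s₂) →
            Γ ⊢Q inst u B ∶ srt s' → Γ ⊢Q app t u ∶ inst u B
    qconv : ∀ {Γ t U V s} → Γ ⊢Q t ∶ U → Γ ⊢Q V ∶ srt s → U ≡β' V → Γ ⊢Q t ∶ V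

  ⊢Q-wf : ∀ {Γ t T} → Γ ⊢Q t ∶ T → WfQ Γ
  ⊢Q-wf (qvar w _ _) = w
  ⊢Q-wf (qsort w _) = w
  ⊢Q-wf (qpi d _ _ _) = ⊢Q-wf d
  ⊢Q-wf (qlam d _ _) = ⊢Q-wf d
  ⊢Q-wf (qapp d _ _ _ _ _) = ⊢Q-wf d
  ⊢Q-wf (qconv d _ _) = ⊢Q-wf d

  record PiGen (Γ : Ctx) (U : Tm 0) (B : Tm 1) : Set where
    constructor pigen
    field
      {s₁ s₂} : S
      dU : Γ ⊢Q U ∶ srt s₁
      L : List ℕ
      body : ∀ y → y ∉ L → (y , U) ∷ Γ ⊢Q inst (fv y) B ∶ srt s₂

  gen-pi : ∀ {Γ U B C} → Γ ⊢Q pi U B ∶ C → PiGen Γ U B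
  gen-pi (qpi dU L f r) = pigen dU L f
  gen-pi (qconv d _ _) = gen-pi d

  dom-∈ : ∀ {A : Set} {Γ : List (ℕ × A)} {y W} → (y , W) ∈ Γ → y ∈ dom Γ
  dom-∈ = ∈-map⁺ proj₁

  dom-++ : ∀ {A : Set} (Δ Γ : List (ℕ × A)) → dom (Δ ++ Γ) ≡ dom Δ ++ dom Γ
  dom-++ Δ Γ = map-++ proj₁ Δ Γ

  fvs⊆dom : ∀ {Γ t T} → Γ ⊢Q t ∶ T → ∀ {z} → z ∈ fvs t → z ∈ dom Γ

  -- The binder case: open the body with a name y different from z.
  body-fvs⊆dom : ∀ {Γ U} {T : ℕ → Tm 0} (b : Tm 1) (L : List ℕ) → (∀ y → y ∉ L → (y , U) ∷ Γ ⊢Q inst (fv y) b ∶ T y) →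
                 ∀ {z} → z ∈ fvs b → z ∈ dom Γ

  fvs⊆dom (qvar w m _) (here refl) = dom-∈ m
  fvs⊆dom (qpi {U = U} {B} dU L f r) p with ∈-++⁻ (fvs U) p
  ... | inj₁ q = fvs⊆dom dU q
  ... | inj₂ q = body-fvs⊆dom B L f q
  fvs⊆dom (qlam {U = U} {b = b} dP L f) p with ∈-++⁻ (fvs U) p
  ... | inj₁ q = fvs⊆dom dP (∈-++⁺ˡ q)
  ... | inj₂ q = body-fvs⊆dom b L f q
  fvs⊆dom (qapp {t = t} dt du _ _ _ _) p with ∈-++⁻ (fvs t) p
  ... | inj₁ q = fvs⊆dom dt q
  ... | inj₂ q = fvs⊆dom du q
  fvs⊆dom (qconv d _ _) p = fvs⊆dom d p

  body-fvs⊆dom b L f {z} p with fvs⊆dom (f y y∉L) (fvs-inst⁺ (fv y) b p)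
    where
      y = fresh (z ∷ L)
      y∉L : y ∉ L
      y∉L h = fresh-∉ (z ∷ L) (there h)
  ... | here z≡y = ⊥-elim (fresh-∉ (z ∷ L) (here (sym z≡y)))
  ... | there z∈Γ = z∈Γ

  infix 4 _⊆_
  _⊆_ : Ctx → Ctx → Set
  Γ ⊆ Γ' = ∀ {q} → q ∈ Γ → q ∈ Γ'

  ⊆-ext : ∀ {Γ Γ' : Ctx} {p} → Γ ⊆ Γ' → p ∷ Γ ⊆ p ∷ Γ'
  ⊆-ext inc (here e) = here e
  ⊆-ext inc (there h) = there (inc h)

  weaken : ∀ {Γ Γ' t T} → Γ ⊢Q t ∶ T → Γ ⊆ Γ' → WfQ Γ' → Γ' ⊢Q t ∶ T
  weaken-body : ∀ {Γ Γ' U s} {T : ℕ → Tm 0} (b : Tm 1) (L : List ℕ) →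
                (∀ y → y ∉ L → (y , U) ∷ Γ ⊢Q inst (fv y) b ∶ T y) → Γ ⊆ Γ' → Γ' ⊢Q U ∶ srt s →
                ∀ y → y ∉ L ++ dom Γ' → (y , U) ∷ Γ' ⊢Q inst (fv y) b ∶ T y

  weaken (qvar w m dT) inc w' = qvar w' (inc m) (weaken dT inc w')
  weaken (qsort w a) inc w' = qsort w' a
  weaken {Γ' = Γ'} (qpi {B = B} dU L f r) inc w' =
    qpi dU' (L ++ dom Γ') (weaken-body B L f inc dU') r
    where dU' = weaken dU inc w'
  weaken {Γ' = Γ'} (qlam {b = b} dP L f) inc w' =
    qlam dP' (L ++ dom Γ') (weaken-body b L f inc (PiGen.dU (gen-pi dP')))
    where dP' = weaken dP inc w'
  weaken {Γ' = Γ'} (qapp {B = B} dt du dP L f dI) inc w' =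
    qapp (weaken dt inc w') (weaken du inc w') dP' (L ++ dom Γ')
      (weaken-body B L f inc (PiGen.dU (gen-pi dP'))) (weaken dI inc w')
    where dP' = weaken dP inc w'
  weaken (qconv d dV c) inc w' = qconv (weaken d inc w') (weaken dV inc w') c

  weaken-body b L f inc dU' y y∉ = weaken (f y (∉-++ˡ L y∉)) (⊆-ext inc) (qcons dU' (∉-++ʳ L y∉))

  weaken-++ : ∀ (Ψ : Ctx) {E t T} → WfQ (Ψ ++ E) → E ⊢Q t ∶ T → Ψ ++ E ⊢Q t ∶ T
  weaken-++ Ψ w d = weaken d (∈-++⁺ʳ Ψ) w

  wf-entry-typed : ∀ {Γ} → WfQ Γ → ∀ {y W} → (y , W) ∈ Γ → ∃ λ s → Γ ⊢Q W ∶ srt s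
  wf-entry-typed (qcons {s = s} d x∉) (here refl) = s , weaken d there (qcons d x∉)
  wf-entry-typed (qcons d x∉) (there m) with wf-entry-typed (⊢Q-wf d) m
  ... | s , e = s , weaken e there (qcons d x∉)

  infix 4 _⊑Q_
  _⊑Q_ : Ctx → Ctx → Set
  G ⊑Q G' = ∀ {y W} → (y , W) ∈ G → ∃ λ W' → (y , W') ∈ G' × W' ≡β' W

  ⊑Q-ext : ∀ {G G' y U} → G ⊑Q G' → (y , U) ∷ G ⊑Q (y , U) ∷ G'
  ⊑Q-ext inc (here refl) = _ , here refl , ε
  ⊑Q-ext inc (there m) with inc m
  ... | W' , m' , c = W' , there m' , c

  -- Weakening along ⊑Q: a variable is retyped by conversion.
  weaken-conv : ∀ {G G' t T} → G ⊢Q t ∶ T → G ⊑Q G' → WfQ G' → G' ⊢Q t ∶ T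
  weaken-conv-body : ∀ {G G' U s} {T : ℕ → Tm 0} (b : Tm 1) (L : List ℕ) →
                     (∀ y → y ∉ L → (y , U) ∷ G ⊢Q inst (fv y) b ∶ T y) → G ⊑Q G' → G' ⊢Q U ∶ srt s →
                     ∀ y → y ∉ L ++ dom G' → (y , U) ∷ G' ⊢Q inst (fv y) b ∶ T y

  weaken-conv (qvar w m dT) inc w' with inc m
  ... | W' , m' , c = qconv (qvar w' m' (proj₂ (wf-entry-typed w' m'))) (weaken-conv dT inc w') c
  weaken-conv (qsort w a) inc w' = qsort w' a
  weaken-conv {G' = G'} (qpi {B = B} dU L f r) inc w' =
    qpi dU' (L ++ dom G') (weaken-conv-body B L f inc dU') r
    where dU' = weaken-conv dU inc w'
  weaken-conv {G' = G'} (qlam {b = b} dP L f) inc w' =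
    qlam dP' (L ++ dom G') (weaken-conv-body b L f inc (PiGen.dU (gen-pi dP')))
    where dP' = weaken-conv dP inc w'
  weaken-conv {G' = G'} (qapp {B = B} dt du dP L f dI) inc w' =
    qapp (weaken-conv dt inc w') (weaken-conv du inc w') dP' (L ++ dom G')
      (weaken-conv-body B L f inc (PiGen.dU (gen-pi dP'))) (weaken-conv dI inc w')
    where dP' = weaken-conv dP inc w'
  weaken-conv (qconv d dV c) inc w' = qconv (weaken-conv d inc w') (weaken-conv dV inc w') c

  weaken-conv-body b L f inc dU' y y∉ =
    weaken-conv (f y (∉-++ˡ L y∉)) (⊑Q-ext inc) (qcons dU' (∉-++ʳ L y∉))

  substCtx : ℕ → Tm 0 → Ctx → Ctx
  substCtx x u = map (λ { (y , W) → y , substF x u W })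

  dom-substCtx : ∀ x u Δ → dom (substCtx x u Δ) ≡ dom Δ
  dom-substCtx x u [] = refl
  dom-substCtx x u ((y , W) ∷ Δ) = cong (y ∷_) (dom-substCtx x u Δ)

  wf-split : ∀ Δ {x U Γ} → WfQ (Δ ++ (x , U) ∷ Γ) → WfQ ((x , U) ∷ Γ)
  wf-split [] w = w
  wf-split (_ ∷ Δ) (qcons d _) = wf-split Δ (⊢Q-wf d)

  wf-notin : ∀ Δ {x U Γ} → WfQ (Δ ++ (x , U) ∷ Γ) → x ∉ dom Δ
  wf-notin ((y , W) ∷ Δ) {x} {U} {Γ} (qcons d y∉) (here refl) =
    y∉ (subst (x ∈_) (sym (dom-++ Δ ((x , U) ∷ Γ))) (∈-++⁺ʳ (dom Δ) (here refl)))
  wf-notin ((y , W) ∷ Δ) (qcons d _) (there h) = wf-notin Δ (⊢Q-wf d) h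

  dom-substCtx-⊆ : ∀ x u Δ (U : Tm 0) Γ {y} → y ∈ dom (substCtx x u Δ ++ Γ) → y ∈ dom (Δ ++ (x , U) ∷ Γ)
  dom-substCtx-⊆ x u Δ U Γ {y} p
    rewrite dom-++ (substCtx x u Δ) Γ | dom-++ Δ ((x , U) ∷ Γ) | dom-substCtx x u Δ with ∈-++⁻ (dom Δ) p
  ... | inj₁ q = ∈-++⁺ˡ q
  ... | inj₂ q = ∈-++⁺ʳ (dom Δ) (there q)

  split-lookup-self : ∀ Δ {x U Γ T} → WfQ (Δ ++ (x , U) ∷ Γ) → (x , T) ∈ Δ ++ (x , U) ∷ Γ → T ≡ U
  split-lookup-self Δ w m with ∈-++⁻ Δ m
  ... | inj₁ q = ⊥-elim (wf-notin Δ w (dom-∈ q))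
  ... | inj₂ (here refl) = refl
  ... | inj₂ (there q) with wf-split Δ w
  ...   | qcons _ x∉Γ = ⊥-elim (x∉Γ (dom-∈ q))

  -- ... and every other declaration is found in the substituted context
  -- (the types declared before x do not mention x).
  split-lookup-other : ∀ Δ {x U Γ z T} u → WfQ (Δ ++ (x , U) ∷ Γ) → x ≢ z → (z , T) ∈ Δ ++ (x , U) ∷ Γ →
                       (z , substF x u T) ∈ substCtx x u Δ ++ Γ
  split-lookup-other Δ u w x≢z m with ∈-++⁻ Δ m
  ... | inj₁ q = ∈-++⁺ˡ (∈-map⁺ _ q)
  ... | inj₂ (here refl) = ⊥-elim (x≢z refl)
  split-lookup-other Δ {x} {T = T} u w x≢z m | inj₂ (there q) with wf-split Δ w
  ... | qcons dU x∉Γ rewrite substF-fresh x u T (λ h → x∉Γ (fvs⊆dom (proj₂ (wf-entry-typed (⊢Q-wf dU) q)) h)) =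
    ∈-++⁺ʳ _ q

  subst-lemma : ∀ Δ {x U Γ t T u} → Δ ++ (x , U) ∷ Γ ⊢Q t ∶ T → Γ ⊢Q u ∶ U →
                substCtx x u Δ ++ Γ ⊢Q substF x u t ∶ substF x u T
  subst-wf : ∀ Δ {x U Γ u} → WfQ (Δ ++ (x , U) ∷ Γ) → Γ ⊢Q u ∶ U → WfQ (substCtx x u Δ ++ Γ)
  subst-body : ∀ Δ {x U Γ u U'} {T : ℕ → Tm 0} (b : Tm 1) (L : List ℕ) →
               (∀ y → y ∉ L → (y , U') ∷ Δ ++ (x , U) ∷ Γ ⊢Q inst (fv y) b ∶ T y) → Γ ⊢Q u ∶ U →
               ∀ y → y ∉ x ∷ L → (y , substF x u U') ∷ substCtx x u Δ ++ Γ ⊢Q inst (fv y) (substF x u b) ∶ substF x u (T y)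

  subst-lemma Δ {x} (qvar {x = z} w m dT) du with x ≟ z
  subst-lemma Δ {x} {U} {u = u} (qvar w m dT) du | yes refl rewrite split-lookup-self Δ w m with wf-split Δ w
  ... | qcons dU x∉Γ rewrite emb-id u | substF-fresh x u U (λ h → x∉Γ (fvs⊆dom dU h)) =
    weaken du (∈-++⁺ʳ _) (subst-wf Δ w du)
  subst-lemma Δ {u = u} (qvar w m dT) du | no x≢z =
    qvar (subst-wf Δ w du) (split-lookup-other Δ u w x≢z m) (subst-lemma Δ dT du)
  subst-lemma Δ (qsort w a) du = qsort (subst-wf Δ w du) a
  subst-lemma Δ {x} (qpi {B = B} dU L f r) du = qpi (subst-lemma Δ dU du) (x ∷ L) (subst-body Δ B L f du) r
  subst-lemma Δ {x} {u = u} (qlam {B = B} {b} dP L f) du =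
    qlam (subst-lemma Δ dP du) (x ∷ L) body
    where
      body : ∀ y → y ∉ x ∷ L → _ ⊢Q inst (fv y) (substF x u b) ∶ inst (fv y) (substF x u B)
      body y y∉ = subst (_ ⊢Q _ ∶_) (substF-inst-fv x u B (λ e → y∉ (here (sym e)))) (subst-body Δ b L f du y y∉)
  subst-lemma Δ {x} {U} {Γ} {u = u} (qapp {t = t} {u = v} {B = B} dt dv dP L f dI) du =
    subst (substCtx x u Δ ++ Γ ⊢Q app (substF x u t) (substF x u v) ∶_) (sym (substF-inst x u v B))
      (qapp (subst-lemma Δ dt du) (subst-lemma Δ dv du) (subst-lemma Δ dP du) (x ∷ L)
        (subst-body Δ B L f du)
        (subst (substCtx x u Δ ++ Γ ⊢Q_∶ srt _) (substF-inst x u v B) (subst-lemma Δ dI du)))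
  subst-lemma Δ {x} {u = u} (qconv d dV c) du = qconv (subst-lemma Δ d du) (subst-lemma Δ dV du) (≡β-substF x u c)

  subst-wf [] (qcons d _) du = ⊢Q-wf d
  subst-wf ((y , W) ∷ Δ) {x} {U} {Γ} {u} (qcons d y∉) du =
    qcons (subst-lemma Δ d du) (λ h → y∉ (dom-substCtx-⊆ x u Δ U Γ h))

  subst-body Δ {x} {u = u} b L f du y y∉ =
    subst (_ ⊢Q_∶ _) (substF-inst-fv x u b (λ e → y∉ (here (sym e))))
      (subst-lemma ((y , _) ∷ Δ) (f y (λ q → y∉ (there q))) du)

  type-validity : ∀ {Γ t T} → Γ ⊢Q t ∶ T → (∃ λ s → T ≡ srt s) ⊎ (∃ λ s → Γ ⊢Q T ∶ srt s)
  type-validity (qvar _ _ dT) = inj₂ (_ , dT)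
  type-validity (qsort _ _) = inj₁ (_ , refl)
  type-validity (qpi _ _ _ _) = inj₁ (_ , refl)
  type-validity (qlam dP _ _) = inj₂ (_ , dP)
  type-validity (qapp _ _ _ _ _ dI) = inj₂ (_ , dI)
  type-validity (qconv _ dV _) = inj₂ (_ , dV)

  rename : ∀ {Γ x U t T y} → (x , U) ∷ Γ ⊢Q t ∶ T → y ∉ dom Γ → y ≢ x →
           (y , U) ∷ Γ ⊢Q substF x (fv y) t ∶ substF x (fv y) T
  rename {Γ} {x} {U} {y = y} d y∉Γ y≢x with ⊢Q-wf d
  ... | qcons dU x∉Γ = subst-lemma [] (weaken d swap wxy) (qvar wy (here refl) (weaken dU there wy))
    where
      wy : WfQ ((y , U) ∷ Γ)
      wy = qcons dU y∉Γ
      wxy : WfQ ((x , U) ∷ (y , U) ∷ Γ)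
      wxy = qcons (weaken dU there wy) λ { (here x≡y) → y≢x (sym x≡y) ; (there h) → x∉Γ h }
      swap : (x , U) ∷ Γ ⊆ (x , U) ∷ (y , U) ∷ Γ
      swap (here e) = here e
      swap (there h) = there (there h)

  named-body : ∀ {Γ x U t T} → (x , U) ∷ Γ ⊢Q t ∶ T →
               ∀ y → y ∉ x ∷ dom Γ → (y , U) ∷ Γ ⊢Q inst (fv y) (close x t) ∶ inst (fv y) (close x T)
  named-body {x = x} {t = t} {T} d y y∉ =
    subst₂ (_ ⊢Q_∶_) (sym (inst-close x (fv y) t)) (sym (inst-close x (fv y) T))
      (rename d (λ h → y∉ (there h)) (λ e → y∉ (here e)))

  named⇒cofinite : ∀ {Γ t T} → Γ ⊢P t ∶ T → Γ ⊢Q t ∶ T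
  named⇒cofinite-wf : ∀ {Γ} → WfP Γ → WfQ Γ

  named⇒cofinite (tvar w m) = qvar w' m (proj₂ (wf-entry-typed w' m))
    where w' = named⇒cofinite-wf w
  named⇒cofinite (tsort w a) = qsort (named⇒cofinite-wf w) a
  named⇒cofinite {Γ} (tpi {x = x} dU dT r) =
    qpi (named⇒cofinite dU) (x ∷ dom Γ) (named-body (named⇒cofinite dT)) r
  named⇒cofinite {Γ} (tlam {x = x} dP dt) =
    qlam (named⇒cofinite dP) (x ∷ dom Γ) (named-body (named⇒cofinite dt))
  named⇒cofinite {Γ} (tapp {t = t} {u} {T = T} {x} dt du) with type-validity (named⇒cofinite dt)
  ... | inj₁ (_ , ())
  ... | inj₂ (_ , dP) with gen-pi dP
  ...   | pigen _ L f =
    subst (Γ ⊢Q app t u ∶_) (inst-close x u T) (qapp (named⇒cofinite dt) du' dP L f dB)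
    where
      du' = named⇒cofinite du
      open FreshFor (fresh-for L (close x T))
      -- the instantiated codomain is typed: substitute u for a fresh opening
      dB : Γ ⊢Q inst u (close x T) ∶ srt _
      dB = subst (Γ ⊢Q_∶ srt _) (substF-inst-fresh y u (close x T) y∉B) (subst-lemma [] (f y y∉L) du')
  named⇒cofinite (tconv d dV c) = qconv (named⇒cofinite d) (named⇒cofinite dV) (≡β⇒≡β' c)

  named⇒cofinite-wf wf-nil = qnil
  named⇒cofinite-wf (wf-cons d x∉) = qcons (named⇒cofinite d) x∉

  infix 4 _↔L*_
  _↔L*_ : PL 0 → PL 0 → Set
  _↔L*_ = EqClosure _⟶L_

  ↔one : ∀ {a b} → a ⟶ b → a ↔* b
  ↔one = return

  ↔sym : ∀ {a b} → a ↔* b → b ↔* a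
  ↔sym = symmetric _⟶_

  infixr 5 _↔∘_
  _↔∘_ : ∀ {a b c} → a ↔* b → b ↔* c → a ↔* c
  _↔∘_ = transitive _⟶_

  ↔≡ : ∀ {a b} → a ≡ b → a ↔* b
  ↔≡ refl = ε

  ↔-piL : ∀ {A A'} B → A ↔* A' → Pi A B ↔* Pi A' B
  ↔-piL B = gmap (λ A → Pi A B) c-piL

  ↔-piR : ∀ A x {M M'} → M ↔* M' → Pi A (closeT x M) ↔* Pi A (closeT x M')
  ↔-piR A x = gmap (λ M → Pi A (closeT x M)) (c-piR x)

  ↔-lamL : ∀ {A A'} B → A ↔* A' → Lam A B ↔* Lam A' B
  ↔-lamL B = gmap (λ A → Lam A B) c-lamL

  ↔-lamR : ∀ A x {M M'} → M ↔* M' → Lam A (closeT x M) ↔* Lam A (closeT x M')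
  ↔-lamR A x = gmap (λ M → Lam A (closeT x M)) (c-lamR x)

  ↔-appL : ∀ {M M'} l → M ↔* M' → App M l ↔* App M' l
  ↔-appL l = gmap (λ M → App M l) c-appL

  ↔-appR : ∀ M {l l'} → l ↔L* l' → App M l ↔* App M l'
  ↔-appR M = gmap (λ l → App M l) c-appR

  ↔L-consM : ∀ {M M'} l → M ↔* M' → Cons M l ↔L* Cons M' l
  ↔L-consM l = gmap (λ M → Cons M l) c-consM

  ↔-esM : ∀ N A x {M M'} → M ↔* M' → ES N A (closeT x M) ↔* ES N A (closeT x M')
  ↔-esM N A x = gmap (λ M → ES N A (closeT x M)) (c-esM x)

  tr-close : ∀ {m} x (t : Tm m) → tr (close x t) ≡ closeT x (tr t)
  trl-close : ∀ {m} x (l : PL m) (t : Tm m) → trl (closeL x l) (close x t) ≡ closeT x (trl l t)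

  tr-close x (bv i) = refl
  tr-close x (fv y) with x ≟ y
  ... | yes _ = refl
  ... | no _ = refl
  tr-close x (srt s) = refl
  tr-close x (pi A B) = cong₂ Pi (tr-close x A) (tr-close x B)
  tr-close x (lam A B) = cong₂ Lam (tr-close x A) (tr-close x B)
  tr-close x (app t u) = trans (cong (λ z → trl (Cons z Nil) (close x t)) (tr-close x u)) (trl-close x (Cons (tr u) Nil) t)

  trl-close x l (bv i) = refl
  trl-close x l (fv y) with x ≟ y
  ... | yes _ = refl
  ... | no _ = refl
  trl-close x l (srt s) = refl
  trl-close x l (pi A B) = cong₂ (λ a b → App (Pi a b) (closeL x l)) (tr-close x A) (tr-close x B)
  trl-close x l (lam A B) = cong₂ (λ a b → App (Lam a b) (closeL x l)) (tr-close x A) (tr-close x B)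
  trl-close x l (app t u) = trans (cong (λ z → trl (Cons z (closeL x l)) (close x t)) (tr-close x u)) (trl-close x (Cons (tr u) l) t)

  open-tr : ∀ y (b : Tm 1) → y ∉ fvs b → closeT y (tr (inst (fv y) b)) ≡ tr b
  open-tr y b y∉ = trans (sym (tr-close y (inst (fv y) b))) (cong tr (close-inst y b y∉))

  fvT-tr : ∀ {m} {z} (t : Tm m) → z ∈ fvT (tr t) → z ∈ fvs t
  fvT-trl : ∀ {m} {z} (l : PL m) (t : Tm m) → z ∈ fvT (trl l t) → z ∈ fvs t ⊎ z ∈ fvL l

  fvT-tr (fv x) (here e) = here e
  fvT-tr (pi A B) p with ∈-++⁻ (fvT (tr A)) p
  ... | inj₁ q = ∈-++⁺ˡ (fvT-tr A q)
  ... | inj₂ q = ∈-++⁺ʳ (fvs A) (fvT-tr B q)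
  fvT-tr (lam A B) p with ∈-++⁻ (fvT (tr A)) p
  ... | inj₁ q = ∈-++⁺ˡ (fvT-tr A q)
  ... | inj₂ q = ∈-++⁺ʳ (fvs A) (fvT-tr B q)
  fvT-tr (app t u) p with fvT-trl (Cons (tr u) Nil) t p
  ... | inj₁ q = ∈-++⁺ˡ q
  ... | inj₂ q with ∈-++⁻ (fvT (tr u)) q
  ...   | inj₁ r = ∈-++⁺ʳ (fvs t) (fvT-tr u r)
  ...   | inj₂ ()

  fvT-trl l (bv i) p = inj₂ p
  fvT-trl l (fv x) (here e) = inj₁ (here e)
  fvT-trl l (fv x) (there p) = inj₂ p
  fvT-trl l (srt s) p = inj₂ p
  fvT-trl l (pi A B) p with ∈-++⁻ (fvT (tr A) ++ fvT (tr B)) p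
  ... | inj₂ q = inj₂ q
  ... | inj₁ q with ∈-++⁻ (fvT (tr A)) q
  ...   | inj₁ r = inj₁ (∈-++⁺ˡ (fvT-tr A r))
  ...   | inj₂ r = inj₁ (∈-++⁺ʳ (fvs A) (fvT-tr B r))
  fvT-trl l (lam A B) p with ∈-++⁻ (fvT (tr A) ++ fvT (tr B)) p
  ... | inj₂ q = inj₂ q
  ... | inj₁ q with ∈-++⁻ (fvT (tr A)) q
  ...   | inj₁ r = inj₁ (∈-++⁺ˡ (fvT-tr A r))
  ...   | inj₂ r = inj₁ (∈-++⁺ʳ (fvs A) (fvT-tr B r))
  fvT-trl l (app t u) p with fvT-trl (Cons (tr u) l) t p
  ... | inj₁ q = inj₁ (∈-++⁺ˡ q)
  ... | inj₂ q with ∈-++⁻ (fvT (tr u)) q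
  ...   | inj₁ r = inj₁ (∈-++⁺ʳ (fvs t) (fvT-tr u r))
  ...   | inj₂ r = inj₂ r

  ∉fvT-tr : ∀ {z} (t : Tm 0) → z ∉ fvs t → z ∉ fvT (tr t)
  ∉fvT-tr t z∉ p = z∉ (fvT-tr t p)

  spine-app : ∀ (l : PL 0) (t : Tm 0) → trl l t ↔* App (tr t) l
  spine-app l (fv x) = ↔sym (↔one (r-fvapp x Nil l) ↔∘ ↔one (c-fv (r-catnil l)))
  spine-app l (srt s) = ε
  spine-app l (pi A B) = ε
  spine-app l (lam A B) = ε
  spine-app l (app t u) =
    spine-app (Cons (tr u) l) t ↔∘
    ↔sym (↔-appL l (spine-app (Cons (tr u) Nil) t) ↔∘
          ↔one (r-app (tr t) (Cons (tr u) Nil) l) ↔∘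
          ↔one (c-appR (r-cons (tr u) Nil l)) ↔∘
          ↔one (c-appR (c-consl (r-catnil l))))

  -- A name for opening the body B of a binder under ⟨𝒜(u)/y⟩_G, chosen
  -- apart from y, u, G and B, as the side conditions of r-pi/r-lam demand.
  record BinderName (y : ℕ) (u : Tm 0) (G : PT 0) (B : Tm 1) : Set where
    field
      x : ℕ
      x≢y : x ≢ y
      x∉u : x ∉ fvs u
      x∉G : x ∉ fvT G
      x∉B : x ∉ fvs B

  binder-name : ∀ y u G B → BinderName y u G B
  binder-name y u G B = record
    { x = x ; x≢y = λ e → x∉ (here e)
    ; x∉u = λ h → x∉ (there (∈-++⁺ˡ h))
    ; x∉G = λ h → x∉ (there (∈-++⁺ʳ (fvs u) (∈-++⁺ˡ h)))
    ; x∉B = λ h → x∉ (there (∈-++⁺ʳ (fvs u) (∈-++⁺ʳ (fvT G) h))) }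
    where
      x = fresh (y ∷ fvs u ++ fvT G ++ fvs B)
      x∉ = fresh-∉ (y ∷ fvs u ++ fvT G ++ fvs B)

  open-tr-substF : ∀ {x y u} (B : Tm 1) → x ≢ y → x ∉ fvs u → x ∉ fvs B →
                   closeT x (tr (substF y u (inst (fv x) B))) ≡ tr (substF y u B)
  open-tr-substF {x} {y} {u} B x≢y x∉u x∉B =
    trans (cong (λ z → closeT x (tr z)) (substF-inst-fv y u B (λ e → x≢y (sym e))))
          (open-tr x (substF y u B) (∉-substF y u B x∉u x∉B))

  -- Elimination of an explicit substitution of a translated term:
  -- ⟨𝒜(u)/y⟩_G 𝒜(T) ↔* 𝒜(T{y:=u}).  By recursion on the height of T
  -- (binder bodies are opened with a fresh name).
  es-elim-sized : ∀ n (T : Tm 0) → size T < n → ∀ y u (G : PT 0) →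
                  ES (tr u) G (closeT y (tr T)) ↔* tr (substF y u T)
  es-elim-sized (suc n) (fv z) _ y u G with y ≟ z
  ... | yes refl rewrite emb-id u =
    ↔one (r-var (tr u) G Nil) ↔∘ ↔one (c-appR (r-esnil (tr u) G)) ↔∘ ↔one (r-nil (tr u))
  ... | no _ = ↔one (r-var' (tr u) G z Nil) ↔∘ ↔one (c-fv (r-esnil (tr u) G))
  es-elim-sized (suc n) (srt s) _ y u G = ↔one (r-srt (tr u) G s)
  es-elim-sized (suc n) (pi A B) (s≤s sz) y u G =
    ↔≡ (cong (λ z → ES (tr u) G (closeT y (Pi (tr A) z))) (sym (open-tr x B x∉B))) ↔∘
    ↔one (r-pi x y (tr u) G (tr A) (tr (inst (fv x) B)) x≢y (∉fvT-tr u x∉u) x∉G) ↔∘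
    ↔-piL _ (es-elim-sized n A (m⊔n<o⇒m<o _ _ sz) y u G) ↔∘
    ↔-piR _ x (es-elim-sized n (inst (fv x) B) (subst (_< n) (sym (size-inst x B)) (m⊔n<o⇒n<o _ _ sz)) y u G) ↔∘
    ↔≡ (cong (Pi _) (open-tr-substF B x≢y x∉u x∉B))
    where open BinderName (binder-name y u G B)
  es-elim-sized (suc n) (lam A B) (s≤s sz) y u G =
    ↔≡ (cong (λ z → ES (tr u) G (closeT y (Lam (tr A) z))) (sym (open-tr x B x∉B))) ↔∘
    ↔one (r-lam x y (tr u) G (tr A) (tr (inst (fv x) B)) x≢y (∉fvT-tr u x∉u) x∉G) ↔∘
    ↔-lamL _ (es-elim-sized n A (m⊔n<o⇒m<o _ _ sz) y u G) ↔∘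
    ↔-lamR _ x (es-elim-sized n (inst (fv x) B) (subst (_< n) (sym (size-inst x B)) (m⊔n<o⇒n<o _ _ sz)) y u G) ↔∘
    ↔≡ (cong (Lam _) (open-tr-substF B x≢y x∉u x∉B))
    where open BinderName (binder-name y u G B)
  es-elim-sized (suc n) (app t v) (s≤s sz) y u G =
    ↔-esM P G y (spine-app (Cons (tr v) Nil) t) ↔∘
    ↔one (r-esapp P G (closeT y (tr t)) (closeL y (Cons (tr v) Nil))) ↔∘
    ↔one (c-appR (r-escons P G (closeT y (tr v)) Nil)) ↔∘
    ↔one (c-appR (c-consl (r-esnil P G))) ↔∘
    ↔-appL _ (es-elim-sized n t (m⊔n<o⇒m<o _ _ sz) y u G) ↔∘
    ↔-appR _ (↔L-consM Nil (es-elim-sized n v (m⊔n<o⇒n<o _ _ sz) y u G)) ↔∘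
    ↔sym (spine-app (Cons (tr (substF y u v)) Nil) (substF y u t))
    where P = tr u

  es-elim : ∀ (T : Tm 0) y u (G : PT 0) → ES (tr u) G (closeT y (tr T)) ↔* tr (substF y u T)
  es-elim T = es-elim-sized (suc (size T)) T ≤-refl

  es-elim-body : ∀ u (G : PT 0) (b : Tm 1) → ES (tr u) G (tr b) ↔* tr (inst u b)
  es-elim-body u G b =
    ↔≡ (cong (ES (tr u) G) (sym (open-tr y b y∉B))) ↔∘
    es-elim (inst (fv y) b) y u G ↔∘
    ↔≡ (cong tr (substF-inst-fresh y u b y∉B))
    where open FreshFor (fresh-for [] b)

  record CommonOpening (L : List ℕ) (B B' : Tm 1) : Set where
    field
      x : ℕ
      x∉L : x ∉ L
      open-B : closeT x (tr (inst (fv x) B)) ≡ tr B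
      open-B' : closeT x (tr (inst (fv x) B')) ≡ tr B'

  common-opening : ∀ L B B' → CommonOpening L B B'
  common-opening L B B' = record
    { x = x ; x∉L = ∉-++ˡ L x∉
    ; open-B = open-tr x B (∉-++ˡ (fvs B) (∉-++ʳ L x∉))
    ; open-B' = open-tr x B' (∉-++ʳ (fvs B) (∉-++ʳ L x∉)) }
    where
      x = fresh (L ++ fvs B ++ fvs B')
      x∉ = fresh-∉ (L ++ fvs B ++ fvs B')

  tr-step : ∀ {t t'} → t ⇒β t' → tr t ↔* tr t'
  tr-step (bβ V b u) = ↔one (r-beta (tr V) (tr b) (tr u) Nil) ↔∘ ↔one (r-nil _) ↔∘ es-elim-body u (tr V) b
  tr-step (bpiL r) = ↔-piL _ (tr-step r)
  tr-step {pi A B} {pi .A B'} (bpiR L f) =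
    ↔≡ (cong (Pi (tr A)) (sym open-B)) ↔∘ ↔-piR (tr A) x (tr-step (f x x∉L)) ↔∘
    ↔≡ (cong (Pi (tr A)) open-B')
    where open CommonOpening (common-opening L B B')
  tr-step (blamL r) = ↔-lamL _ (tr-step r)
  tr-step {lam A B} {lam .A B'} (blamR L f) =
    ↔≡ (cong (Lam (tr A)) (sym open-B)) ↔∘ ↔-lamR (tr A) x (tr-step (f x x∉L)) ↔∘
    ↔≡ (cong (Lam (tr A)) open-B')
    where open CommonOpening (common-opening L B B')
  tr-step {app t u} {app t' .u} (bappL r) =
    spine-app _ t ↔∘ ↔-appL _ (tr-step r) ↔∘ ↔sym (spine-app _ t')
  tr-step {app t u} {app .t u'} (bappR r) =
    spine-app _ t ↔∘ ↔-appR _ (↔L-consM Nil (tr-step r)) ↔∘ ↔sym (spine-app _ t)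

  tr-conv : ∀ {t t'} → t ≡β' t' → tr t ↔* tr t'
  tr-conv = gfold (eqc-isEquivalence _⟶_) tr tr-step

  dom-trEnv : ∀ Γ → dom (trEnv Γ) ≡ dom Γ
  dom-trEnv [] = refl
  dom-trEnv ((x , T) ∷ Γ) = cong (x ∷_) (dom-trEnv Γ)

  ∈-trEnv : ∀ {Γ x T} → (x , T) ∈ Γ → (x , tr T) ∈ trEnv Γ
  ∈-trEnv = ∈-map⁺ _

  ⊑-refl : ∀ {Γ} → Γ ⊑ Γ
  ⊑-refl m = _ , m , ε

  -- The instantiated codomain ⟨𝒜(u)/⟩_{𝒜(U)} 𝒜(B) is a PTSC type: an
  -- instance of the cut rule cut₄ at a fresh opening of B.
  es-body-typed : ∀ {Γ s y} u U (B : Tm 1) → y ∉ fvs B → Wf (trEnv Γ) → trEnv Γ ⊢ tr u ∶ tr U →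
                  (y , tr U) ∷ trEnv Γ ⊢ tr (inst (fv y) B) ∶ Srt s → trEnv Γ ⊢ ES (tr u) (tr U) (tr B) ∶ Srt s
  es-body-typed u U B y∉ w du dB = subst (λ z → _ ⊢ ES _ _ z ∶ Srt _) (open-tr _ B y∉) (cut₄ {Δ = []} du dB ⊑-refl w)

  -- Parts (1) and (3) for the cofinite PTS.  `translate` also returns the
  -- well-formedness of the translated context, which the cut rules need.
  -- `translate-spine` types 𝒜_l(t) from a typing of l against (a type
  -- convertible to) 𝒜(T); `translate-app-spine` is its application case,
  -- which pushes the argument onto the list.
  translate : ∀ {Γ t T} → Γ ⊢Q t ∶ T → Wf (trEnv Γ) × trEnv Γ ⊢ tr t ∶ tr T
  translate-spine : ∀ {Γ t T} → Γ ⊢Q t ∶ T → Wf (trEnv Γ) → ∀ {A l B s} →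
                    trEnv Γ ⊢ A ∶ Srt s → A ↔* tr T → trEnv Γ ⨾ A ⊢ l ∶ B → trEnv Γ ⊢ trl l t ∶ B
  translate-app-spine : ∀ {Γ t u U B s s₂} → Γ ⊢Q t ∶ pi U B → Γ ⊢Q u ∶ U → Γ ⊢Q pi U B ∶ srt s →
                        (L : List ℕ) → (∀ y → y ∉ L → (y , U) ∷ Γ ⊢Q inst (fv y) B ∶ srt s₂) →
                        Wf (trEnv Γ) → ∀ {A l C s'} →
                        trEnv Γ ⊢ A ∶ Srt s' → A ↔* tr (inst u B) → trEnv Γ ⨾ A ⊢ l ∶ C →
                        trEnv Γ ⊢ trl l (app t u) ∶ C
  translate-wf : ∀ {Γ} → WfQ Γ → Wf (trEnv Γ)

  translate (qvar w m dT) = translate-wf w , var (ax (proj₂ (translate dT))) (∈-trEnv m)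
  translate (qsort w a) = translate-wf w , sort (translate-wf w) a
  translate {Γ} (qpi {U = U} {B} dU L f r) =
    proj₁ (translate dU) ,
    subst (λ z → trEnv Γ ⊢ Pi (tr U) z ∶ Srt _) (open-tr y B y∉B) (pi (proj₂ (translate dU)) (proj₂ (translate (f y y∉L))) r)
    where open FreshFor (fresh-for L B)
  translate {Γ} (qlam {U = U} {B} {b} dP L f) =
    proj₁ (translate dP) ,
    subst₂ (λ z w → trEnv Γ ⊢ Lam (tr U) z ∶ Pi (tr U) w) open-b open-B
      (lam (subst (λ z → trEnv Γ ⊢ Pi (tr U) z ∶ Srt _) (sym open-B) (proj₂ (translate dP))) (proj₂ (translate (f x x∉L))))
    where open CommonOpening (common-opening L b B) renaming (open-B to open-b; open-B' to open-B)
  translate (qapp dt du dP L f dI) =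
    proj₁ (translate du) , translate-app-spine dt du dP L f (proj₁ (translate du)) (proj₂ (translate dI)) ε (ax (proj₂ (translate dI)))
  translate (qconv d dV c) = proj₁ (translate d) , convr (proj₂ (translate d)) (proj₂ (translate dV)) (tr-conv c)

  translate-spine (qvar w m dT) w' dA c lA = var (convl lA (proj₂ (translate dT)) c) (∈-trEnv m)
  translate-spine d@(qsort _ _) w' dA c lA = cut₃ (convr (proj₂ (translate d)) dA (↔sym c)) lA
  translate-spine d@(qpi _ _ _ _) w' dA c lA = cut₃ (convr (proj₂ (translate d)) dA (↔sym c)) lA
  translate-spine d@(qlam _ _ _) w' dA c lA = cut₃ (convr (proj₂ (translate d)) dA (↔sym c)) lA
  translate-spine (qapp dt du dP L f dI) w' dA c lA = translate-app-spine dt du dP L f w' dA c lA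
  translate-spine (qconv d dV c') w' dA c lA = translate-spine d w' dA (c ↔∘ ↔sym (tr-conv c')) lA

  translate-app-spine {u = u} {U} {B} dt du dP L f w' dA c lA =
    translate-spine dt w' (proj₂ (translate dP)) ε
      (Πl (proj₂ (translate dP)) (proj₂ (translate du)) (convl lA dES (c ↔∘ ↔sym (es-elim-body u (tr U) B))))
    where
      open FreshFor (fresh-for L B)
      dES = es-body-typed u U B y∉B w' (proj₂ (translate du)) (proj₂ (translate (f y y∉L)))

  translate-wf qnil = wf-nil
  translate-wf {(x , T) ∷ Γ} (qcons d x∉) = wf-cons (proj₂ (translate d)) (subst (x ∉_) (sym (dom-trEnv Γ)) x∉)

  -- A spine becomes an iterated
  -- application and an explicit substitution ⟨N/⟩ M the instantiation of
  -- (the back-translation of) M; to state this uniformly under binders we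
  -- use parallel substitution of bound indices.
  liftσ : ∀ {m n} → (Fin m → Tm n) → Fin (suc m) → Tm (suc n)
  liftσ σ zero = bv zero
  liftσ σ (suc i) = ren suc (σ i)

  sub : ∀ {m n} → (Fin m → Tm n) → Tm m → Tm n
  sub σ (bv i) = σ i
  sub σ (fv x) = fv x
  sub σ (srt s) = srt s
  sub σ (pi A B) = pi (sub σ A) (sub (liftσ σ) B)
  sub σ (lam A B) = lam (sub σ A) (sub (liftσ σ) B)
  sub σ (app t u) = app (sub σ t) (sub σ u)

  σ₀ : ∀ {n} → Tm n → Fin (suc n) → Tm n
  σ₀ u zero = u
  σ₀ u (suc i) = bv i

  apps : ∀ {n} → Tm n → List (Tm n) → Tm n
  apps t [] = t
  apps t (u ∷ us) = apps (app t u) us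

  bk : ∀ {n} → PT n → Tm n
  bkl : ∀ {n} → PL n → List (Tm n)

  bk (Pi A B) = pi (bk A) (bk B)
  bk (Lam A M) = lam (bk A) (bk M)
  bk (Srt s) = srt s
  bk (BV i l) = apps (bv i) (bkl l)
  bk (FV x l) = apps (fv x) (bkl l)
  bk (App M l) = apps (bk M) (bkl l)
  bk (ES N A M) = sub (σ₀ (bk N)) (bk M)

  bkl Nil = []
  bkl (Cons M l) = bk M ∷ bkl l
  bkl (Cat l l') = bkl l ++ bkl l'
  bkl (ESL N A l) = map (sub (σ₀ (bk N))) (bkl l)

  apps-++ : ∀ {n} (t : Tm n) xs ys → apps t (xs ++ ys) ≡ apps (apps t xs) ys
  apps-++ t [] ys = refl
  apps-++ t (x ∷ xs) ys = apps-++ (app t x) xs ys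

  close-apps : ∀ {n} x (t : Tm n) ts → close x (apps t ts) ≡ apps (close x t) (map (close x) ts)
  close-apps x t [] = refl
  close-apps x t (u ∷ us) = close-apps x (app t u) us

  sub-apps : ∀ {m n} (σ : Fin m → Tm n) t ts → sub σ (apps t ts) ≡ apps (sub σ t) (map (sub σ) ts)
  sub-apps σ t [] = refl
  sub-apps σ t (u ∷ us) = sub-apps σ (app t u) us

  substF-apps : ∀ {n} x u (t : Tm n) ts → substF x u (apps t ts) ≡ apps (substF x u t) (map (substF x u) ts)
  substF-apps x u t [] = refl
  substF-apps x u t (v ∷ vs) = substF-apps x u (app t v) vs

  fvsL : ∀ {n} → List (Tm n) → List ℕ
  fvsL [] = []
  fvsL (t ∷ ts) = fvs t ++ fvsL ts

  lift-inject : ∀ {m n} {f : Fin m → Fin n} {f' : Fin (suc m) → Fin (suc n)} →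
                (∀ i → f' (inject₁ i) ≡ inject₁ (f i)) → ∀ i → liftF f' (inject₁ i) ≡ inject₁ (liftF f i)
  lift-inject h zero = refl
  lift-inject h (suc i) = cong suc (h i)

  close-ren : ∀ {m n} x (f : Fin m → Fin n) (f' : Fin (suc m) → Fin (suc n)) →
              (∀ i → f' (inject₁ i) ≡ inject₁ (f i)) → f' (fromℕ m) ≡ fromℕ n →
              ∀ t → close x (ren f t) ≡ ren f' (close x t)
  close-ren x f f' h1 h2 (bv i) = cong bv (sym (h1 i))
  close-ren x f f' h1 h2 (fv y) with x ≟ y
  ... | yes _ = cong bv (sym h2)
  ... | no _ = refl
  close-ren x f f' h1 h2 (srt s) = refl
  close-ren x f f' h1 h2 (pi A B) =
    cong₂ pi (close-ren x f f' h1 h2 A) (close-ren x (liftF f) (liftF f') (lift-inject h1) (cong suc h2) B)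
  close-ren x f f' h1 h2 (lam A B) =
    cong₂ lam (close-ren x f f' h1 h2 A) (close-ren x (liftF f) (liftF f') (lift-inject h1) (cong suc h2) B)
  close-ren x f f' h1 h2 (app t u) = cong₂ app (close-ren x f f' h1 h2 t) (close-ren x f f' h1 h2 u)

  close-suc : ∀ {n} x (t : Tm n) → close x (ren suc t) ≡ ren suc (close x t)
  close-suc x t = close-ren x suc suc (λ i → refl) refl t

  liftσ-inject : ∀ {m n x} {σ : Fin m → Tm n} {σ' : Fin (suc m) → Tm (suc n)} →
                 (∀ i → σ' (inject₁ i) ≡ close x (σ i)) → ∀ i → liftσ σ' (inject₁ i) ≡ close x (liftσ σ i)
  liftσ-inject h zero = refl
  liftσ-inject {x = x} {σ} h (suc i) = trans (cong (ren suc) (h i)) (sym (close-suc x (σ i)))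

  close-sub : ∀ {m n} x (σ : Fin m → Tm n) (σ' : Fin (suc m) → Tm (suc n)) →
              (∀ i → σ' (inject₁ i) ≡ close x (σ i)) → σ' (fromℕ m) ≡ bv (fromℕ n) →
              ∀ t → close x (sub σ t) ≡ sub σ' (close x t)
  close-sub x σ σ' h1 h2 (bv i) = sym (h1 i)
  close-sub x σ σ' h1 h2 (fv y) with x ≟ y
  ... | yes _ = sym h2
  ... | no _ = refl
  close-sub x σ σ' h1 h2 (srt s) = refl
  close-sub x σ σ' h1 h2 (pi A B) =
    cong₂ pi (close-sub x σ σ' h1 h2 A) (close-sub x (liftσ σ) (liftσ σ') (liftσ-inject h1) (cong (ren suc) h2) B)
  close-sub x σ σ' h1 h2 (lam A B) =
    cong₂ lam (close-sub x σ σ' h1 h2 A) (close-sub x (liftσ σ) (liftσ σ') (liftσ-inject h1) (cong (ren suc) h2) B)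
  close-sub x σ σ' h1 h2 (app t u) = cong₂ app (close-sub x σ σ' h1 h2 t) (close-sub x σ σ' h1 h2 u)

  close-σ₀ : ∀ {n} x (u : Tm n) t → close x (sub (σ₀ u) t) ≡ sub (σ₀ (close x u)) (close x t)
  close-σ₀ x u t = close-sub x (σ₀ u) (σ₀ (close x u)) h refl t
    where
      h : ∀ i → σ₀ (close x u) (inject₁ i) ≡ close x (σ₀ u i)
      h zero = refl
      h (suc i) = refl

  record Outer {k} (u : Tm 0) (σ : Fin (suc k) → Tm k) : Set where
    constructor outer
    field
      outer-top : σ (fromℕ k) ≡ emb u
      outer-inj : ∀ i → σ (inject₁ i) ≡ bv i

  outer-lift : ∀ {k} {u} {σ : Fin (suc k) → Tm k} → Outer u σ → Outer u (liftσ σ)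
  outer-lift {u = u} (outer top inj) = outer (trans (cong (ren suc) top) (ren-emb suc u)) h
    where
      h : ∀ j → liftσ _ (inject₁ j) ≡ bv j
      h zero = refl
      h (suc j) = cong (ren suc) (inj j)

  outer₀ : ∀ u → Outer u (σ₀ u)
  outer₀ u = outer (sym (emb-id u)) (λ ())

  sub-close : ∀ {k} y u {σ : Fin (suc k) → Tm k} → Outer u σ → ∀ t → sub σ (close y t) ≡ substF y u t
  sub-close y u o (bv i) = Outer.outer-inj o i
  sub-close y u o (fv z) with y ≟ z
  ... | yes _ = Outer.outer-top o
  ... | no _ = refl
  sub-close y u o (srt s) = refl
  sub-close y u o (pi A B) = cong₂ pi (sub-close y u o A) (sub-close y u (outer-lift o) B)
  sub-close y u o (lam A B) = cong₂ lam (sub-close y u o A) (sub-close y u (outer-lift o) B)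
  sub-close y u o (app t v) = cong₂ app (sub-close y u o t) (sub-close y u o v)

  sub-inst : ∀ {k} u {σ : Fin (suc k) → Tm k} → Outer u σ → ∀ b → sub σ b ≡ inst u b
  sub-inst u o (bv i) with strip i in eq
  ... | just j rewrite strip-just i eq = Outer.outer-inj o j
  ... | nothing rewrite strip-nothing i eq = Outer.outer-top o
  sub-inst u o (fv y) = refl
  sub-inst u o (srt s) = refl
  sub-inst u o (pi A B) = cong₂ pi (sub-inst u o A) (sub-inst u (outer-lift o) B)
  sub-inst u o (lam A B) = cong₂ lam (sub-inst u o A) (sub-inst u (outer-lift o) B)
  sub-inst u o (app t v) = cong₂ app (sub-inst u o t) (sub-inst u o v)

  sub₀-inst : ∀ u (b : Tm 1) → sub (σ₀ u) b ≡ inst u b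
  sub₀-inst u = sub-inst u (outer₀ u)

  bk-close-FV : ∀ {m} x y (l : PL m) → bk (closeT x (FV y l)) ≡ apps (close x (fv y)) (bkl (closeL x l))
  bk-close-FV x y l with x ≟ y
  ... | yes _ = refl
  ... | no _ = refl

  bk-close : ∀ {m} x (M : PT m) → bk (closeT x M) ≡ close x (bk M)
  bkl-close : ∀ {m} x (l : PL m) → bkl (closeL x l) ≡ map (close x) (bkl l)

  bk-close x (Pi A B) = cong₂ pi (bk-close x A) (bk-close x B)
  bk-close x (Lam A B) = cong₂ lam (bk-close x A) (bk-close x B)
  bk-close x (Srt s) = refl
  bk-close x (BV i l) = trans (cong (apps (bv (inject₁ i))) (bkl-close x l)) (sym (close-apps x (bv i) (bkl l)))
  bk-close x (FV y l) =
    trans (bk-close-FV x y l) (trans (cong (apps (close x (fv y))) (bkl-close x l)) (sym (close-apps x (fv y) (bkl l))))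
  bk-close x (App M l) = trans (cong₂ apps (bk-close x M) (bkl-close x l)) (sym (close-apps x (bk M) (bkl l)))
  bk-close x (ES N A M) = trans (cong₂ (λ a b → sub (σ₀ a) b) (bk-close x N) (bk-close x M)) (sym (close-σ₀ x (bk N) (bk M)))

  bkl-close x Nil = refl
  bkl-close x (Cons M l) = cong₂ _∷_ (bk-close x M) (bkl-close x l)
  bkl-close x (Cat l l') = trans (cong₂ _++_ (bkl-close x l) (bkl-close x l')) (sym (map-++ (close x) (bkl l) (bkl l')))
  bkl-close x (ESL N A l) =
    trans (cong₂ (λ a b → map (sub (σ₀ a)) b) (bk-close x N) (bkl-close x l))
      (trans (sym (map-∘ (bkl l)))
        (trans (map-cong (λ t → sym (close-σ₀ x (bk N) t)) (bkl l)) (map-∘ (bkl l))))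

  bk-ES-close : ∀ P G y (M : PT 0) → bk (ES P G (closeT y M)) ≡ substF y (bk P) (bk M)
  bk-ES-close P G y M = trans (cong (sub (σ₀ (bk P))) (bk-close y M)) (sub-close y (bk P) (outer₀ (bk P)) (bk M))

  bk-ES : ∀ N A (M : PT 1) → bk (ES N A M) ≡ inst (bk N) (bk M)
  bk-ES N A M = sub₀-inst (bk N) (bk M)

  bk-ESL-close : ∀ P G y (l : PL 0) → bkl (ESL P G (closeL y l)) ≡ map (substF y (bk P)) (bkl l)
  bk-ESL-close P G y l = trans (cong (map (sub (σ₀ (bk P)))) (bkl-close y l))
    (trans (sym (map-∘ (bkl l))) (map-cong (sub-close y (bk P) (outer₀ (bk P))) (bkl l)))

  bk-tr : ∀ {m} (t : Tm m) → bk (tr t) ≡ t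
  bk-trl : ∀ {m} (l : PL m) (t : Tm m) → bk (trl l t) ≡ apps t (bkl l)

  bk-tr (bv i) = refl
  bk-tr (fv x) = refl
  bk-tr (srt s) = refl
  bk-tr (pi A B) = cong₂ pi (bk-tr A) (bk-tr B)
  bk-tr (lam A B) = cong₂ lam (bk-tr A) (bk-tr B)
  bk-tr (app t u) = trans (bk-trl (Cons (tr u) Nil) t) (cong (app t) (bk-tr u))

  bk-trl l (bv i) = refl
  bk-trl l (fv x) = refl
  bk-trl l (srt s) = refl
  bk-trl l (pi A B) = cong (λ z → apps z (bkl l)) (bk-tr (pi A B))
  bk-trl l (lam A B) = cong (λ z → apps z (bkl l)) (bk-tr (lam A B))
  bk-trl l (app t u) = trans (bk-trl (Cons (tr u) l) t) (cong (λ z → apps (app t z) (bkl l)) (bk-tr u))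

  -- bk introduces no free names (needed for the freshness side conditions
  -- of r-pi and r-lam when they are mapped back).
  fvs-sub-body : ∀ {m n} {z} (σ : Fin m → Tm n) (A : Tm m) (B : Tm (suc m)) →
                 z ∈ fvs B ⊎ Σ (Fin (suc m)) (λ i → z ∈ fvs (liftσ σ i)) →
                 z ∈ fvs A ++ fvs B ⊎ Σ (Fin m) (λ i → z ∈ fvs (σ i))
  fvs-sub-body σ A B (inj₁ r) = inj₁ (∈-++⁺ʳ (fvs A) r)
  fvs-sub-body σ A B (inj₂ (suc i , r)) = inj₂ (i , subst (_ ∈_) (fvs-ren suc (σ i)) r)

  fvs-sub : ∀ {m n} {z} (σ : Fin m → Tm n) t → z ∈ fvs (sub σ t) → z ∈ fvs t ⊎ Σ (Fin m) (λ i → z ∈ fvs (σ i))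
  fvs-sub σ (bv i) p = inj₂ (i , p)
  fvs-sub σ (fv x) p = inj₁ p
  fvs-sub σ (pi A B) p with ∈-++⁻ (fvs (sub σ A)) p
  ... | inj₁ q = Sum.map₁ ∈-++⁺ˡ (fvs-sub σ A q)
  ... | inj₂ q = fvs-sub-body σ A B (fvs-sub (liftσ σ) B q)
  fvs-sub σ (lam A B) p with ∈-++⁻ (fvs (sub σ A)) p
  ... | inj₁ q = Sum.map₁ ∈-++⁺ˡ (fvs-sub σ A q)
  ... | inj₂ q = fvs-sub-body σ A B (fvs-sub (liftσ σ) B q)
  fvs-sub σ (app A B) p with ∈-++⁻ (fvs (sub σ A)) p
  ... | inj₁ q = Sum.map₁ ∈-++⁺ˡ (fvs-sub σ A q)
  ... | inj₂ q = Sum.map₁ (∈-++⁺ʳ (fvs A)) (fvs-sub σ B q)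

  fvs-sub₀ : ∀ {n} {z} (u : Tm n) t → z ∈ fvs (sub (σ₀ u) t) → z ∈ fvs u ⊎ z ∈ fvs t
  fvs-sub₀ u t p with fvs-sub (σ₀ u) t p
  ... | inj₁ q = inj₂ q
  ... | inj₂ (zero , q) = inj₁ q

  fvs-apps : ∀ {n} {z} (t : Tm n) ts → z ∈ fvs (apps t ts) → z ∈ fvs t ⊎ z ∈ fvsL ts
  fvs-apps t [] p = inj₁ p
  fvs-apps t (u ∷ us) p with fvs-apps (app t u) us p
  ... | inj₂ q = inj₂ (∈-++⁺ʳ (fvs u) q)
  ... | inj₁ q with ∈-++⁻ (fvs t) q
  ...   | inj₁ r = inj₁ r
  ...   | inj₂ r = inj₂ (∈-++⁺ˡ r)

  fvsL-++ : ∀ {n} {z} (xs ys : List (Tm n)) → z ∈ fvsL (xs ++ ys) → z ∈ fvsL xs ⊎ z ∈ fvsL ys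
  fvsL-++ [] ys p = inj₂ p
  fvsL-++ (x ∷ xs) ys p with ∈-++⁻ (fvs x) p
  ... | inj₁ q = inj₁ (∈-++⁺ˡ q)
  ... | inj₂ q = Sum.map₁ (∈-++⁺ʳ (fvs x)) (fvsL-++ xs ys q)

  fvsL-map-sub₀ : ∀ {n} {z} (u : Tm n) ts → z ∈ fvsL (map (sub (σ₀ u)) ts) → z ∈ fvs u ⊎ z ∈ fvsL ts
  fvsL-map-sub₀ u (t ∷ ts) p with ∈-++⁻ (fvs (sub (σ₀ u) t)) p
  ... | inj₁ q = Sum.map₂ ∈-++⁺ˡ (fvs-sub₀ u t q)
  ... | inj₂ q = Sum.map₂ (∈-++⁺ʳ (fvs t)) (fvsL-map-sub₀ u ts q)

  fvs-bk : ∀ {n} {z} (M : PT n) → z ∈ fvs (bk M) → z ∈ fvT M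
  fvsL-bkl : ∀ {n} {z} (l : PL n) → z ∈ fvsL (bkl l) → z ∈ fvL l

  fvs-bk (Pi A B) p with ∈-++⁻ (fvs (bk A)) p
  ... | inj₁ q = ∈-++⁺ˡ (fvs-bk A q)
  ... | inj₂ q = ∈-++⁺ʳ (fvT A) (fvs-bk B q)
  fvs-bk (Lam A B) p with ∈-++⁻ (fvs (bk A)) p
  ... | inj₁ q = ∈-++⁺ˡ (fvs-bk A q)
  ... | inj₂ q = ∈-++⁺ʳ (fvT A) (fvs-bk B q)
  fvs-bk (BV i l) p with fvs-apps (bv i) (bkl l) p
  ... | inj₂ q = fvsL-bkl l q
  fvs-bk (FV x l) p with fvs-apps (fv x) (bkl l) p
  ... | inj₁ (here z≡x) = here z≡x
  ... | inj₂ q = there (fvsL-bkl l q)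
  fvs-bk (App M l) p with fvs-apps (bk M) (bkl l) p
  ... | inj₁ q = ∈-++⁺ˡ (fvs-bk M q)
  ... | inj₂ q = ∈-++⁺ʳ (fvT M) (fvsL-bkl l q)
  fvs-bk (ES N A M) p with fvs-sub₀ (bk N) (bk M) p
  ... | inj₁ q = ∈-++⁺ˡ (fvs-bk N q)
  ... | inj₂ q = ∈-++⁺ʳ (fvT N) (∈-++⁺ʳ (fvT A) (fvs-bk M q))

  fvsL-bkl (Cons M l) p with ∈-++⁻ (fvs (bk M)) p
  ... | inj₁ q = ∈-++⁺ˡ (fvs-bk M q)
  ... | inj₂ q = ∈-++⁺ʳ (fvT M) (fvsL-bkl l q)
  fvsL-bkl (Cat l l') p with fvsL-++ (bkl l) (bkl l') p
  ... | inj₁ q = ∈-++⁺ˡ (fvsL-bkl l q)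
  ... | inj₂ q = ∈-++⁺ʳ (fvL l) (fvsL-bkl l' q)
  fvsL-bkl (ESL N A l) p with fvsL-map-sub₀ (bk N) (bkl l) p
  ... | inj₁ q = ∈-++⁺ˡ (fvs-bk N q)
  ... | inj₂ q = ∈-++⁺ʳ (fvT N) (∈-++⁺ʳ (fvT A) (fvsL-bkl l q))

  ≡-apps : ∀ {t t'} ls → t ≡β' t' → apps t ls ≡β' apps t' ls
  ≡-apps [] c = c
  ≡-apps (u ∷ us) c = ≡-apps us (≡-appL u c)

  -- Convertible arguments give convertible openings (by a β-expansion).
  inst-conv : ∀ {n n'} (b : Tm 1) → n ≡β' n' → inst n b ≡β' inst n' b
  inst-conv {n} {n'} b c = ≡sym (≡one (bβ n b n)) ≡∘ ≡-appR (lam n b) c ≡∘ ≡one (bβ n b n')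

  -- Convertible bodies give convertible openings (by a β-expansion).
  body-conv : ∀ n x {m m'} → m ≡β' m' → inst n (close x m) ≡β' inst n (close x m')
  body-conv n x {m} {m'} c =
    ≡sym (≡one (bβ n (close x m) n)) ≡∘ ≡-appL n (≡-lam-close n x c) ≡∘ ≡one (bβ n (close x m') n)

  map-sub₀-conv : ∀ {n n'} → n ≡β' n' → ∀ (t : Tm 0) ls →
                  apps t (map (sub (σ₀ n)) ls) ≡β' apps t (map (sub (σ₀ n')) ls)
  map-sub₀-conv c t [] = ε
  map-sub₀-conv {n} {n'} c t (b ∷ bs) =
    ≡-apps (map (sub (σ₀ n)) bs) (≡-appR t (≡≡ (sub₀-inst n b) ≡∘ inst-conv b c ≡∘ ≡≡ (sym (sub₀-inst n' b)))) ≡∘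
    map-sub₀-conv c (app t (sub (σ₀ n') b)) bs

  map-substF-fresh : ∀ z u (ts : List (Tm 0)) → z ∉ fvsL ts → map (substF z u) ts ≡ ts
  map-substF-fresh z u [] z∉ = refl
  map-substF-fresh z u (t ∷ ts) z∉ =
    cong₂ _∷_ (substF-fresh z u t (∉-++ˡ (fvs t) z∉)) (map-substF-fresh z u ts (∉-++ʳ (fvs t) z∉))

  ∉fvsL-map : ∀ z x u (ts : List (Tm 0)) → z ∉ fvs u → z ∉ fvsL ts → z ∉ fvsL (map (substF x u) ts)
  ∉fvsL-map z x u [] z∉u z∉ ()
  ∉fvsL-map z x u (t ∷ ts) z∉u z∉ =
    ∉-++ (fvs (substF x u t)) (∉-substF x u t z∉u (∉-++ˡ (fvs t) z∉)) (∉fvsL-map z x u ts z∉u (∉-++ʳ (fvs t) z∉))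

  plug-spine : ∀ x n t {z} (ls : List (Tm 0)) → x ≢ z → z ∉ fvs n → z ∉ fvsL ls →
               substF z t (substF x n (apps (fv z) ls)) ≡ apps t (map (substF x n) ls)
  plug-spine x n t {z} ls x≢z z∉n z∉ls = begin
    substF z t (substF x n (apps (fv z) ls))
      ≡⟨ cong (substF z t) (substF-apps x n (fv z) ls) ⟩
    substF z t (apps (substF x n (fv z)) ls')
      ≡⟨ cong (λ h → substF z t (apps h ls')) (substF-fv-no n x≢z) ⟩
    substF z t (apps (fv z) ls')
      ≡⟨ substF-apps z t (fv z) ls' ⟩
    apps (substF z t (fv z)) (map (substF z t) ls')
      ≡⟨ cong₂ apps (trans (substF-fv-yes z t) (emb-id t)) (map-substF-fresh z t ls' (∉fvsL-map z x n ls z∉n z∉ls)) ⟩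
    apps t ls' ∎
    where
      open ≡-Reasoning
      ls' = map (substF x n) ls

  bk-step : ∀ {M M'} → M ⟶ M' → bk M ≡β' bk M'
  bkl-step : ∀ {l l'} → l ⟶L l' → ∀ t → apps t (bkl l) ≡β' apps t (bkl l')

  bk-push : ∀ x y P G (M : PT 0) → x ≢ y → x ∉ fvT P →
            substF y (bk P) (bk (closeT x M)) ≡ bk (closeT x (ES P G (closeT y M)))
  bk-push x y P G M x≢y x∉P = begin
    substF y (bk P) (bk (closeT x M))    ≡⟨ cong (substF y (bk P)) (bk-close x M) ⟩
    substF y (bk P) (close x (bk M))     ≡⟨ substF-close y (bk P) x (bk M) (λ e → x≢y (sym e)) (λ h → x∉P (fvs-bk P h)) ⟩
    close x (substF y (bk P) (bk M))     ≡⟨ cong (close x) (sym (bk-ES-close P G y M)) ⟩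
    close x (bk (ES P G (closeT y M)))   ≡⟨ sym (bk-close x (ES P G (closeT y M))) ⟩
    bk (closeT x (ES P G (closeT y M)))  ∎
    where open ≡-Reasoning

  bk-step (r-beta A M N l) =
    ≡-apps (bkl l) (≡one (subst (app (lam (bk A) (bk M)) (bk N) ⇒β_) (sym (sub₀-inst (bk N) (bk M))) (bβ _ _ _)))
  bk-step (r-nil M) = ε
  bk-step (r-fvapp x l l') = ≡≡ (sym (apps-++ (fv x) (bkl l) (bkl l')))
  bk-step (r-app M l l') = ≡≡ (sym (apps-++ (bk M) (bkl l) (bkl l')))
  bk-step (r-lam x y P G A M x≢y x∉P x∉G) =
    ≡≡ (trans (bk-ES-close P G y (Lam A (closeT x M))) (cong₂ lam (sym (bk-ES-close P G y A)) (bk-push x y P G M x≢y x∉P)))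
  bk-step (r-var P G l) = ≡≡ (sub-apps (σ₀ (bk P)) (bv zero) (bkl l))
  bk-step (r-var' P G x l) = ≡≡ (sub-apps (σ₀ (bk P)) (fv x) (bkl l))
  bk-step (r-esapp P G M l) = ≡≡ (sub-apps (σ₀ (bk P)) (bk M) (bkl l))
  bk-step (r-pi x y P G A M x≢y x∉P x∉G) =
    ≡≡ (trans (bk-ES-close P G y (Pi A (closeT x M))) (cong₂ pi (sym (bk-ES-close P G y A)) (bk-push x y P G M x≢y x∉P)))
  bk-step (r-srt P G s) = ε
  bk-step (c-piL r) = ≡-piL _ (bk-step r)
  bk-step (c-piR {A} {B} {B'} x r) =
    ≡≡ (cong (pi (bk A)) (bk-close x B)) ≡∘ ≡-pi-close (bk A) x (bk-step r) ≡∘ ≡≡ (sym (cong (pi (bk A)) (bk-close x B')))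
  bk-step (c-lamL r) = ≡-lamL _ (bk-step r)
  bk-step (c-lamR {A} {B} {B'} x r) =
    ≡≡ (cong (lam (bk A)) (bk-close x B)) ≡∘ ≡-lam-close (bk A) x (bk-step r) ≡∘ ≡≡ (sym (cong (lam (bk A)) (bk-close x B')))
  bk-step (c-fv {x} r) = bkl-step r (fv x)
  bk-step (c-appL {l = l} r) = ≡-apps (bkl l) (bk-step r)
  bk-step (c-appR {M} r) = bkl-step r (bk M)
  bk-step (c-esN {N} {N'} {A} {M} r) = ≡≡ (bk-ES N A M) ≡∘ inst-conv (bk M) (bk-step r) ≡∘ ≡≡ (sym (bk-ES N' A M))
  bk-step (c-esA r) = ε
  bk-step (c-esM {N} {A} {M} {M'} x r) =
    ≡≡ (trans (bk-ES N A (closeT x M)) (cong (inst (bk N)) (bk-close x M))) ≡∘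
    body-conv (bk N) x (bk-step r) ≡∘
    ≡≡ (sym (trans (bk-ES N A (closeT x M')) (cong (inst (bk N)) (bk-close x M'))))

  bkl-step (r-cons M l' l) t = ε
  bkl-step (r-catnil l) t = ε
  bkl-step (r-assoc l l' l'') t = ≡≡ (cong (apps t) (++-assoc (bkl l) (bkl l') (bkl l'')))
  bkl-step (r-nilcat l) t = ≡≡ (cong (apps t) (++-identityʳ (bkl l)))
  bkl-step (r-esnil P G) t = ε
  bkl-step (r-escons P G M l) t = ε
  bkl-step (r-escat P G l l') t = ≡≡ (cong (apps t) (map-++ (sub (σ₀ (bk P))) (bkl l) (bkl l')))
  bkl-step (c-consM {l = l} r) t = ≡-apps (bkl l) (≡-appR t (bk-step r))
  bkl-step (c-consl {M} r) t = bkl-step r (app t (bk M))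
  bkl-step (c-catL {l₁} {l₁'} {l₂} r) t =
    ≡≡ (apps-++ t (bkl l₁) (bkl l₂)) ≡∘ ≡-apps (bkl l₂) (bkl-step r t) ≡∘ ≡≡ (sym (apps-++ t (bkl l₁') (bkl l₂)))
  bkl-step (c-catR {l₁} {l₂} {l₂'} r) t =
    ≡≡ (apps-++ t (bkl l₁) (bkl l₂)) ≡∘ bkl-step r (apps t (bkl l₁)) ≡∘ ≡≡ (sym (apps-++ t (bkl l₁) (bkl l₂')))
  bkl-step (c-esN {N} {N'} {A} {l} r) t = map-sub₀-conv (bk-step r) t (bkl l)
  bkl-step (c-esA r) t = ε
  -- Under ⟨N/x⟩: run the step on a fresh head z, substitute, and plug t for z.
  bkl-step (c-esl {N} {A} {l} {l'} x r) t =
    ≡≡ (cong (apps t) (bk-ESL-close N A x l)) ≡∘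
    ≡≡ (sym (plug-spine x n t ls x≢z z∉n z∉ls)) ≡∘
    ≡β-substF z t (≡β-substF x n (bkl-step r (fv z))) ≡∘
    ≡≡ (plug-spine x n t ls' x≢z z∉n z∉ls') ≡∘
    ≡≡ (sym (cong (apps t) (bk-ESL-close N A x l')))
    where
      n = bk N
      ls = bkl l
      ls' = bkl l'
      K = x ∷ fvs n ++ fvsL ls ++ fvsL ls'
      z = fresh K
      x≢z : x ≢ z
      x≢z e = fresh-∉ K (here (sym e))
      z∉n : z ∉ fvs n
      z∉n h = fresh-∉ K (there (∈-++⁺ˡ h))
      z∉ls : z ∉ fvsL ls
      z∉ls h = fresh-∉ K (there (∈-++⁺ʳ (fvs n) (∈-++⁺ˡ h)))
      z∉ls' : z ∉ fvsL ls'
      z∉ls' h = fresh-∉ K (there (∈-++⁺ʳ (fvs n) (∈-++⁺ʳ (fvsL ls) h)))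

  bk-conv : ∀ {M M'} → M ↔* M' → bk M ≡β' bk M'
  bk-conv = gfold (eqc-isEquivalence _⇒β_) bk bk-step

  bkE : ℕ × PT 0 → ℕ × Tm 0
  bkE (x , A) = x , bk A

  bkEnv : CCtx → Ctx
  bkEnv = map bkE

  ∈-bkEnv : ∀ {Γ x A} → (x , A) ∈ Γ → (x , bk A) ∈ bkEnv Γ
  ∈-bkEnv = ∈-map⁺ bkE

  dom-bkEnv : ∀ Γ → dom (bkEnv Γ) ≡ dom Γ
  dom-bkEnv [] = refl
  dom-bkEnv ((x , A) ∷ Γ) = cong (x ∷_) (dom-bkEnv Γ)

  bkEnv-trEnv : ∀ Γ → bkEnv (trEnv Γ) ≡ Γ
  bkEnv-trEnv [] = refl
  bkEnv-trEnv ((x , T) ∷ Γ) = cong₂ _∷_ (cong (x ,_) (bk-tr T)) (bkEnv-trEnv Γ)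

  ⊑⇒⊑Q : ∀ {Γ₁ Γ₂} → Γ₁ ⊑ Γ₂ → bkEnv Γ₁ ⊑Q bkEnv Γ₂
  ⊑⇒⊑Q sq m with ∈-map⁻ bkE m
  ... | (y , A₀) , m₀ , refl with sq m₀
  ...   | B , mB , c = bk B , ∈-bkEnv mB , ≡sym (bk-conv c)

  bkEnv-split : ∀ (Δ : CCtx) x A Γ → bkEnv (Δ ++ (x , A) ∷ Γ) ≡ bkEnv Δ ++ (x , bk A) ∷ bkEnv Γ
  bkEnv-split Δ x A Γ = map-++ bkE Δ ((x , A) ∷ Γ)

  bk-⊑ : ∀ P x A Δ {Γ Δ'} → substEnv P x A Δ ++ Γ ⊑ Δ' → substCtx x (bk P) (bkEnv Δ) ++ bkEnv Γ ⊑Q bkEnv Δ'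
  bk-⊑ P x A Δ {Γ} sq m = ⊑⇒⊑Q sq (subst (_ ∈_) (bkEnv-sub Δ) m)
    where
      bkEnv-sub : ∀ Δ → substCtx x (bk P) (bkEnv Δ) ++ bkEnv Γ ≡ bkEnv (substEnv P x A Δ ++ Γ)
      bkEnv-sub [] = refl
      bkEnv-sub ((y , D) ∷ Δ) = cong₂ _∷_ (cong (y ,_) (sym (bk-ES-close P A x D))) (bkEnv-sub Δ)

  bk-substTy : ∀ P x A C → bk (substTy P x A C) ≡ substF x (bk P) (bk C)
  bk-substTy P x A (Pi a b) = bk-ES-close P A x (Pi a b)
  bk-substTy P x A (Lam a b) = bk-ES-close P A x (Lam a b)
  bk-substTy P x A (Srt s) = refl
  bk-substTy P x A (BV i l) = bk-ES-close P A x (BV i l)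
  bk-substTy P x A (FV y l) = bk-ES-close P A x (FV y l)
  bk-substTy P x A (App M l) = bk-ES-close P A x (App M l)
  bk-substTy P x A (ES N G M) = bk-ES-close P A x (ES N G M)

  -- The meaning of a list typing E ; a ⊢ ls : c in the PTS: a is a type and
  -- the spine ls takes every head of type a to type c, in every well-formed
  -- extension of E.
  record SpineTyping (E : Ctx) (a : Tm 0) (ls : List (Tm 0)) (c : Tm 0) : Set where
    constructor spine-typing
    field
      {src-sort} : S
      src : E ⊢Q a ∶ srt src-sort
      run : ∀ Ψ {t} → WfQ (Ψ ++ E) → Ψ ++ E ⊢Q t ∶ a → Ψ ++ E ⊢Q apps t ls ∶ c

  SpineTyping-resp : ∀ {E E' a a' ls ls' c c'} → E ≡ E' → a ≡ a' → ls ≡ ls' → c ≡ c' →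
                     SpineTyping E a ls c → SpineTyping E' a' ls' c'
  SpineTyping-resp refl refl refl refl st = st

  -- Spine typings are stable under substitution x := p and weakening along ⊑Q:
  -- run the spine on a fresh head z, substitute, then plug the real head for z.
  subst-spine-typing : ∀ Δ {x U Γ p b ls c G} → SpineTyping (Δ ++ (x , U) ∷ Γ) b ls c → Γ ⊢Q p ∶ U →
                       substCtx x p Δ ++ Γ ⊑Q G → WfQ G →
                       SpineTyping G (substF x p b) (map (substF x p) ls) (substF x p c)
  subst-spine-typing Δ {x} {U} {Γ} {p} {b} {ls} {c} {G} (spine-typing src run) dp sq wG = spine-typing src' run'
    where
      src' = weaken-conv (subst-lemma Δ src dp) sq wG
      run' : ∀ Ψ {t} → WfQ (Ψ ++ G) → Ψ ++ G ⊢Q t ∶ substF x p b →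
             Ψ ++ G ⊢Q apps t (map (substF x p) ls) ∶ substF x p c
      run' Ψ {t} w dt =
        subst₂ (Ψ ++ G ⊢Q_∶_) (plug-spine x p t ls x≢z z∉p z∉ls) (substF-fresh z t _ (∉-substF x p c z∉p z∉c))
          (subst-lemma [] (weaken-conv dz (⊑Q-ext sq') (qcons (weaken-++ Ψ w src') z∉ΨG)) dt)
        where
          E = Δ ++ (x , U) ∷ Γ
          K = x ∷ dom (Ψ ++ G) ++ dom E ++ fvs p ++ fvsL ls ++ fvs c
          z = fresh K
          x≢z : x ≢ z
          x≢z e = fresh-∉ K (here (sym e))
          z∉ΨG : z ∉ dom (Ψ ++ G)
          z∉ΨG h = fresh-∉ K (there (∈-++⁺ˡ h))
          z∉E : z ∉ dom E
          z∉E h = fresh-∉ K (there (∈-++⁺ʳ (dom (Ψ ++ G)) (∈-++⁺ˡ h)))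
          z∉p : z ∉ fvs p
          z∉p h = fresh-∉ K (there (∈-++⁺ʳ (dom (Ψ ++ G)) (∈-++⁺ʳ (dom E) (∈-++⁺ˡ h))))
          z∉ls : z ∉ fvsL ls
          z∉ls h = fresh-∉ K (there (∈-++⁺ʳ (dom (Ψ ++ G)) (∈-++⁺ʳ (dom E) (∈-++⁺ʳ (fvs p) (∈-++⁺ˡ h)))))
          z∉c : z ∉ fvs c
          z∉c h = fresh-∉ K (there (∈-++⁺ʳ (dom (Ψ ++ G)) (∈-++⁺ʳ (dom E) (∈-++⁺ʳ (fvs p) (∈-++⁺ʳ (fvsL ls) h)))))
          wz : WfQ ((z , b) ∷ E)
          wz = qcons src z∉E
          dz : (z , substF x p b) ∷ substCtx x p Δ ++ Γ ⊢Q substF x p (apps (fv z) ls) ∶ substF x p c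
          dz = subst-lemma ((z , b) ∷ Δ) (run ((z , b) ∷ []) wz (qvar wz (here refl) (weaken src there wz))) dp
          sq' : substCtx x p Δ ++ Γ ⊑Q Ψ ++ G
          sq' m with sq m
          ... | W' , m' , cv = W' , ∈-++⁺ʳ Ψ m' , cv

  back-wf : ∀ {Γ} → Wf Γ → WfQ (bkEnv Γ)
  back : ∀ {Γ M C} → Γ ⊢ M ∶ C → bkEnv Γ ⊢Q bk M ∶ bk C
  back-list : ∀ {Γ A l C} → Γ ⨾ A ⊢ l ∶ C → SpineTyping (bkEnv Γ) (bk A) (bkl l) (bk C)

  back-wf wf-nil = qnil
  back-wf {(x , A) ∷ Γ} (wf-cons d x∉) = qcons (back d) (subst (x ∉_) (sym (dom-bkEnv Γ)) x∉)

  back (sort w a) = qsort (back-wf w) a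
  back {Γ} (pi {A = A} {B} {x} dA dB r) =
    subst (λ z → bkEnv Γ ⊢Q pi (bk A) z ∶ srt _) (sym (bk-close x B))
      (qpi (back dA) (x ∷ dom (bkEnv Γ)) (named-body (back dB)) r)
  back {Γ} (lam {A = A} {B} {M} {x} dP dM) =
    subst₂ (λ m b → bkEnv Γ ⊢Q lam (bk A) m ∶ pi (bk A) b) (sym (bk-close x M)) (sym (bk-close x B))
      (qlam dP' (x ∷ dom (bkEnv Γ)) (named-body (back dM)))
    where dP' = subst (λ z → bkEnv Γ ⊢Q pi (bk A) z ∶ srt _) (bk-close x B) (back dP)
  back (var lA m) with back-list lA
  ... | spine-typing src run = run [] (⊢Q-wf src) (qvar (⊢Q-wf src) (∈-bkEnv m) src)
  back (convr d dB c) = qconv (back d) (back dB) (bk-conv c)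
  back (cut₃ d lA) = SpineTyping.run (back-list lA) [] (⊢Q-wf (back d)) (back d)
  back (cut₄ {Γ} {Δ} {Δ'} {P} {A} {M} {C} {x} dP dM sq wf) =
    subst₂ (bkEnv Δ' ⊢Q_∶_) (sym (bk-ES-close P A x M)) (sym (bk-substTy P x A C))
      (weaken-conv (subst-lemma (bkEnv Δ) (subst (_⊢Q bk M ∶ bk C) (bkEnv-split Δ x A Γ) (back dM)) (back dP))
        (bk-⊑ P x A Δ sq) (back-wf wf))

  back-list (ax dA) = spine-typing (back dA) (λ Ψ w dt → dt)
  back-list {Γ} (Πl {A = A} {B} {M} {l} {C} dPi dM lC) with back-list lC
  ... | spine-typing src run = spine-typing (back dPi) run'
    where
      src' = subst (bkEnv Γ ⊢Q_∶ srt _) (bk-ES M A B) src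
      run' : ∀ Ψ {t} → WfQ (Ψ ++ bkEnv Γ) → Ψ ++ bkEnv Γ ⊢Q t ∶ pi (bk A) (bk B) →
             Ψ ++ bkEnv Γ ⊢Q apps (app t (bk M)) (bkl l) ∶ bk C
      run' Ψ w dt with gen-pi (weaken-++ Ψ w (back dPi))
      ... | pigen _ L f =
        run Ψ w (subst (Ψ ++ bkEnv Γ ⊢Q app _ (bk M) ∶_) (sym (bk-ES M A B))
          (qapp dt (weaken-++ Ψ w (back dM)) (weaken-++ Ψ w (back dPi)) L f (weaken-++ Ψ w src')))
  back-list (convr lA dB c) with back-list lA
  ... | spine-typing src run = spine-typing src (λ Ψ w dt → qconv (run Ψ w dt) (weaken-++ Ψ w (back dB)) (bk-conv c))
  back-list (convl lA dB c) with back-list lA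
  ... | spine-typing src run = spine-typing (back dB) (λ Ψ w dt → run Ψ w (qconv dt (weaken-++ Ψ w src) (≡sym (bk-conv c))))
  back-list {Γ} (cut₁ {l' = l'} {l = l} {B = C} l'A lB) with back-list l'A | back-list lB
  ... | spine-typing src run | spine-typing _ run₂ =
    spine-typing src (λ Ψ {t} w dt → subst (Ψ ++ bkEnv Γ ⊢Q_∶ bk C) (sym (apps-++ t (bkl l') (bkl l)))
                                       (run₂ Ψ w (run Ψ w dt)))
  back-list (cut₂ {Γ} {Δ} {Δ'} {P} {A} {B} {l} {C} {x} dP lB sq wf) =
    SpineTyping-resp refl (sym (bk-ES-close P A x B)) (sym (bk-ESL-close P A x l)) (sym (bk-ES-close P A x C))
      (subst-spine-typing (bkEnv Δ) (SpineTyping-resp (bkEnv-split Δ x A Γ) refl refl refl (back-list lB))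
        (back dP) (bk-⊑ P x A Δ sq) (back-wf wf))

  back-tr : ∀ {Γ X s} → trEnv Γ ⊢ tr X ∶ Srt s → Γ ⊢Q X ∶ srt s
  back-tr {Γ} {X} {s} d = subst₂ (_⊢Q_∶ srt s) (bkEnv-trEnv Γ) (bk-tr X) (back d)

  substF-piChain : ∀ {n} (xs : Vec ℕ n) (Ts : Vec (Tm 0) n) R x u →
                   All (x ≢_) (toList xs) → All (λ y → y ∉ fvs u) (toList xs) →
                   substF x u (piChain (toList (zip xs Ts)) R)
                     ≡ piChain (toList (zip xs (Vec.map (substF x u) Ts))) (substF x u R)
  substF-piChain []ᵥ []ᵥ R x u []ₐ []ₐ = refl
  substF-piChain (y ∷ᵥ ys) (U ∷ᵥ Us) R x u (x≢y ∷ₐ x≢ys) (y∉u ∷ₐ ys∉u) =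
    cong (pi (substF x u U))
      (trans (substF-close x u y (piChain (toList (zip ys Us)) R) x≢y y∉u)
             (cong (close y) (substF-piChain ys Us R x u x≢ys ys∉u)))

  -- Part (2) for the cofinite PTS, by induction on the length of the list:
  -- type t₁ against the first Π, then the remaining arguments against the
  -- instantiated chain, which ⟨𝒜(t₁)/⟩ computes to by es-elim-body.
  translate-args : ∀ (Γ : Ctx) (n : ℕ) (xs : Vec ℕ n) (Ts ts : Vec (Tm 0) n) (T : Tm 0) (s : S) →
    Unique (toList xs) →
    All (λ x → x ∉ dom Γ) (toList xs) →
    (∀ (i : Fin n) → Γ ⊢Q lookup ts i ∶ seqSubst (take (toℕ i) (toList (zip xs ts))) (lookup Ts i)) →
    Γ ⊢Q piChain (toList (zip xs Ts)) T ∶ srt s →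
    trEnv Γ ⨾ tr (piChain (toList (zip xs Ts)) T) ⊢ consList (map tr (toList ts)) ∶ tr (seqSubst (toList (zip xs ts)) T)
  translate-args Γ zero []ᵥ []ᵥ []ᵥ T s _ _ _ dT = ax (proj₂ (translate dT))
  translate-args Γ (suc n) (x ∷ᵥ xs) (T₁ ∷ᵥ Ts) (t₁ ∷ᵥ ts) T s (x∉xs ∷ₚ uniq) (x∉Γ ∷ₐ xs∉Γ) dts dPi
    with gen-pi dPi
  ... | pigen {s₂ = s₂} _ L f =
    Πl (proj₂ (translate dPi)) (proj₂ (translate dt₁))
      (convl rest dES (↔≡ (cong tr (sym instantiated)) ↔∘ ↔sym (es-elim-body t₁ (tr T₁) b)))
    where
      R = piChain (toList (zip xs Ts)) T
      b = close x R
      dt₁ : Γ ⊢Q t₁ ∶ T₁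
      dt₁ = dts zero
      open FreshFor (fresh-for L b)
      dES : trEnv Γ ⊢ ES (tr t₁) (tr T₁) (tr b) ∶ Srt s₂
      dES = es-body-typed t₁ T₁ b y∉B (proj₁ (translate dt₁)) (proj₂ (translate dt₁)) (proj₂ (translate (f y y∉L)))
      Ts' = Vec.map (substF x t₁) Ts
      R' = piChain (toList (zip xs Ts')) (substF x t₁ T)
      instantiated : inst t₁ b ≡ R'
      instantiated = trans (inst-close x t₁ R)
        (substF-piChain xs Ts T x t₁ x∉xs (All.map (λ y∉Γ h → y∉Γ (fvs⊆dom dt₁ h)) xs∉Γ))
      dR' : Γ ⊢Q R' ∶ srt s₂
      dR' = subst (Γ ⊢Q_∶ srt s₂) (trans (substF-inst-fresh y t₁ b y∉B) instantiated) (subst-lemma [] (f y y∉L) dt₁)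
      dts' : ∀ (i : Fin n) → Γ ⊢Q lookup ts i ∶ seqSubst (take (toℕ i) (toList (zip xs ts))) (lookup Ts' i)
      dts' i = subst (λ z → Γ ⊢Q lookup ts i ∶ seqSubst (take (toℕ i) (toList (zip xs ts))) z)
                 (sym (lookup-map i (substF x t₁) Ts)) (dts (suc i))
      rest = translate-args Γ n xs Ts' ts (substF x t₁ T) s₂ uniq xs∉Γ dts' dR'

theorem4p3 : (S : Set) (Ax : S → S → Set) (Rl : S → S → S → Set) →
    let open Theory S Ax Rl in
    (∀ {Γ t T} → Γ ⊢P t ∶ T → trEnv Γ ⊢ tr t ∶ tr T)
    ×
    (∀ (Γ : Ctx) (n : ℕ) (xs : Vec ℕ n) (Ts ts : Vec (Tm 0) n) (T : Tm 0) (s : S) →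
      Unique (toList xs) →
      All (λ x → x ∉ dom Γ) (toList xs) →
      (∀ (i : Fin n) →
        Γ ⊢P lookup ts i ∶ seqSubst (take (toℕ i) (toList (zip xs ts))) (lookup Ts i)) →
      trEnv Γ ⊢ tr (piChain (toList (zip xs Ts)) T) ∶ Srt s →
      trEnv Γ ⨾ tr (piChain (toList (zip xs Ts)) T)
        ⊢ consList (map tr (toList ts)) ∶ tr (seqSubst (toList (zip xs ts)) T))
    ×
    (∀ {Γ} → WfP Γ → Wf (trEnv Γ))
theorem4p3 S Ax Rl =
    (λ d → proj₂ (translate (named⇒cofinite d)))
  , (λ Γ n xs Ts ts T s uniq xs∉Γ dts dPi →
       translate-args Γ n xs Ts ts T s uniq xs∉Γ (λ i → named⇒cofinite (dts i)) (back-tr dPi))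
  , (λ w → translate-wf (named⇒cofinite-wf w))
  where open Correctness S Ax Rl
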